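{- Let $n,r$ be positive integers with $n(r+1)$ even, and let $G=K_{n,\ldots,n,n+2}$ be the complete $(r+1)$-partite graph with $r$ parts of size $n$ and one part of size $n+2$. Then $\mathrm{def}(G)\leq nr+2$.
   Context: A complete $(r+1)$-partite graph has its vertex set partitioned into $r+1$ nonempty independent sets with every two vertices in different parts adjacent. For a proper edge-coloring $\alpha$ of a graph $G$ (with positive integer colors) and a vertex $v$, let $S(v,\alpha)$ be the set of colors on edges incident to $v$, and $\mathrm{def}(v,\alpha)=\max S(v,\alpha)-\min S(v,\alpha)-|S(v,\alpha)|+1$. The deficiency of $G$ is $\mathrm{def}(G)=\min_\alpha \sum_{v\in V(G)}\mathrm{def}(v,\alpha)$ over all proper edge-colorings $\alpha$ of $G$; equivalently, the minimum number of pendant edges whose attachment to $G$ yields a graph admitting an interval coloring (a proper edge-coloring with colors $1,\ldots,t$, all used, in which every vertex's color set is an integer interval). -}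

module Defs where

open import Data.Nat using (ℕ; zero; suc; _+_; _*_; _∸_; _≤_; _<_; _⊔_; _⊓_; _<ᵇ_; _≡ᵇ_; NonZero)
open import Data.Nat.DivMod using (_/_)
open import Data.Nat.Properties using () renaming (_≟_ to _≟ℕ_)
open import Data.Fin using (Fin; toℕ)
open import Data.Bool using (Bool; true; false; not; if_then_else_)
open import Data.List using (List; []; _∷_; map; filter; length; allFin; foldr; deduplicate)
open import Data.Nat.ListAction using (sum)
open import Data.Product using (Σ)
open import Relation.Binary.PropositionalEquality using (_≡_; _≢_)
open import Relation.Nullary.Decidable using (Dec; yes; no)

record SimpleGraph (N : ℕ) : Set where
  field
    adj    : Fin N → Fin N → Bool
    sym    : ∀ u v → adj u v ≡ adj v u
    irrefl : ∀ v → adj v v ≡ false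
open SimpleGraph public

Adj : ∀ {N} → SimpleGraph N → Fin N → Fin N → Set
Adj G u v = adj G u v ≡ true

-- A proper edge-coloring with positive integer colors, given as a symmetric
-- function on adjacent pairs (values on non-adjacent pairs are irrelevant).
record ProperEdgeColoring {N : ℕ} (G : SimpleGraph N) : Set where
  field
    col      : Fin N → Fin N → ℕ
    col-sym  : ∀ u v → Adj G u v → col u v ≡ col v u
    col-pos  : ∀ u v → Adj G u v → 1 ≤ col u v
    proper   : ∀ u v w → Adj G u v → Adj G u w → v ≢ w → col u v ≢ col u w
open ProperEdgeColoring public

incidentColors : ∀ {N} (G : SimpleGraph N) → ProperEdgeColoring G → Fin N → List ℕ
incidentColors G α v =
  map (col α v) (filter (λ u → isTrue (adj G v u)) (allFin _))
  where
  isTrue : (b : Bool) → Dec (b ≡ true)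
  isTrue true  = yes _≡_.refl
  isTrue false = no (λ ())

colorSet : ∀ {N} (G : SimpleGraph N) → ProperEdgeColoring G → Fin N → List ℕ
colorSet G α v = deduplicate _≟ℕ_ (incidentColors G α v)

maxL : List ℕ → ℕ
maxL = foldr _⊔_ 0

minL : List ℕ → ℕ
minL []       = 0
minL (x ∷ xs) = foldr _⊓_ x xs

-- def(v,α) = max S − min S − |S| + 1 ; (convention: 0 if S is empty)
vertexDef : ∀ {N} (G : SimpleGraph N) → ProperEdgeColoring G → Fin N → ℕ
vertexDef G α v with colorSet G α v
... | []           = 0
... | S@(_ ∷ _)    = (maxL S ∸ minL S + 1) ∸ length S

totalDef : ∀ {N} (G : SimpleGraph N) → ProperEdgeColoring G → ℕ
totalDef G α = sum (map (vertexDef G α) (allFin _))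

-- def(G) ≤ k, i.e. min_α Σ_v def(v,α) ≤ k (unfolded: some proper edge-coloring achieves ≤ k)
DefAtMost : ∀ {N} → SimpleGraph N → ℕ → Set
DefAtMost G k = Σ (ProperEdgeColoring G) (λ α → totalDef G α ≤ k)

-- The complete (r+1)-partite graph K_{n,…,n,n+2} on vertices 0,…,n r + n + 1:
-- vertex x with x < n r lies in part ⌊x/n⌋ ∈ {0,…,r−1} (each of size n),
-- and vertices n r,…,n r + n + 1 form part r (size n+2).
partOf : (n r : ℕ) → .{{NonZero n}} → ℕ → ℕ
partOf n r x = if x <ᵇ n * r then x / n else r

Kpart : (n r : ℕ) → .{{NonZero n}} → SimpleGraph (n * r + (n + 2))
Kpart n r = record
  { adj    = λ u v → not (partOf n r (toℕ u) ≡ᵇ partOf n r (toℕ v))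
  ; sym    = λ u v → symB (partOf n r (toℕ u)) (partOf n r (toℕ v))
  ; irrefl = λ v → irr (partOf n r (toℕ v))
  }
  where
  symB : ∀ a b → not (a ≡ᵇ b) ≡ not (b ≡ᵇ a)
  symB zero zero = _≡_.refl
  symB zero (suc b) = _≡_.refl
  symB (suc a) zero = _≡_.refl
  symB (suc a) (suc b) = symB a b
  irr : ∀ a → not (a ≡ᵇ a) ≡ false
  irr zero = _≡_.refl
  irr (suc a) = irr a

-- Let M = 2m + 1 and colour the complete graph on {0, …, M − 1} by u ⊕ v = u + v mod M; vertex u misses
-- exactly the colour u ⊕ u, and u ↦ u ⊕ u is a bijection.  Blow every vertex up into b copies and give the
-- edge between copy ξ of u and copy ξ' of v the colour ξ + ξ' + b (u ⊕ v), pushed up by the number of gaps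
-- that row u has opened before that block: one just before block u and one just before block u + m + 1.
-- These gaps take the edges to two poles A and B, and "diagonal" vertices are joined to each u by the
-- missing colour u ⊕ u.  Every copy of a vertex of K_M then sees an interval of colours, and so does every
-- diagonal vertex.
--   If r = 2m + 1 is odd, the r parts of size n are the blown-up vertices (b = n) and the big part holds n
-- diagonal vertices and the poles, each pole of deficiency 1.  If n = 2b is even, let M = 2r + 1: part i
-- holds b copies of vertex i + 1 and b copies of 2r − i, which are joined by colour 0 in K_M, so block 0 is
-- never used; the big part holds b diagonal vertices, b copies of vertex 0 and the poles, and the
-- deficiency is at most b + 1 + (b + 1) = n + 2.

module Submission where

open import Defs hiding (sym)
open import Data.Bool using (true; false; T)
open import Data.Empty using (⊥; ⊥-elim)
open import Data.Fin using (Fin; toℕ) renaming (zero to fzero; suc to fsuc)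
open import Data.Fin.Properties using (toℕ<n; toℕ-injective)
open import Data.List using (List; []; _∷_; map; filter; length; tabulate; allFin; deduplicate)
open import Data.List.Properties using (filter-all; length-map)
open import Data.List.Relation.Unary.All using (All; []; _∷_)
import Data.List.Relation.Unary.All as All
open import Data.List.Relation.Unary.All.Properties using (all-filter)
import Data.List.Relation.Unary.All.Properties as AllP
open import Data.List.Relation.Unary.AllPairs using (AllPairs; []; _∷_)
import Data.List.Relation.Unary.AllPairs.Properties as AllPairs
open import Data.List.Relation.Unary.Unique.Propositional using (Unique)
open import Data.List.Relation.Unary.Unique.Propositional.Properties using (allFin⁺)
open import Data.Nat
open import Data.Nat.DivMod
open import Data.Nat.Divisibility using (_∣_; _∣?_; divides)
open import Data.Nat.ListAction using (sum)
open import Data.Nat.Primality using (prime?; euclidsLemma)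
open import Data.Nat.Properties
open import Algebra.Properties.CommutativeSemigroup +-commutativeSemigroup using (interchange; x∙yz≈y∙xz; xy∙z≈xz∙y)
open import Data.Nat.Tactic.RingSolver using (solve-∀)
open import Data.Product using (_×_; _,_; proj₁; proj₂; uncurry; ∃-syntax)
open import Data.Sum using (_⊎_; inj₁; inj₂)
open import Data.Unit using (⊤; tt)
open import Function using (_∘_)
open import Relation.Binary using (tri<; tri≈; tri>)
open import Relation.Binary.PropositionalEquality
open import Relation.Nullary using (¬_; Dec; yes; no; contradiction; ¬?)
open import Relation.Nullary.Decidable using (from-yes; _⊎-dec_)
open import Relation.Unary using (Decidable)

𝟙 : {P : Set} → Dec P → ℕ
𝟙 (yes _) = 1
𝟙 (no _)  = 0

𝟙≤1 : {P : Set} (p : Dec P) → 𝟙 p ≤ 1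
𝟙≤1 (yes _) = s≤s z≤n
𝟙≤1 (no _)  = z≤n

𝟙-mono : {P Q : Set} (p : Dec P) (q : Dec Q) → (P → Q) → 𝟙 p ≤ 𝟙 q
𝟙-mono (yes x) (yes _) _  = ≤-refl
𝟙-mono (yes x) (no ¬q) f  = contradiction (f x) ¬q
𝟙-mono (no _)  _       _  = z≤n

𝟙-cong : {P Q : Set} (p : Dec P) (q : Dec Q) → (P → Q) → (Q → P) → 𝟙 p ≡ 𝟙 q
𝟙-cong p q f g = ≤-antisym (𝟙-mono p q f) (𝟙-mono q p g)

𝟙-yes : {P : Set} (p : Dec P) → P → 𝟙 p ≡ 1
𝟙-yes (yes _) _ = refl
𝟙-yes (no ¬p) x = contradiction x ¬p

𝟙-no : {P : Set} (p : Dec P) → ¬ P → 𝟙 p ≡ 0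
𝟙-no (yes x) ¬p = contradiction x ¬p
𝟙-no (no _)  _  = refl

sumBelow : ℕ → (ℕ → ℕ) → ℕ
sumBelow zero    F = 0
sumBelow (suc N) F = F 0 + sumBelow N (F ∘ suc)

sumBelow-mono : ∀ N {F G : ℕ → ℕ} → (∀ t → F t ≤ G t) → sumBelow N F ≤ sumBelow N G
sumBelow-mono zero    _   = z≤n
sumBelow-mono (suc N) F≤G = +-mono-≤ (F≤G 0) (sumBelow-mono N (F≤G ∘ suc))

sumBelow-cong : ∀ N {F G : ℕ → ℕ} → (∀ t → F t ≡ G t) → sumBelow N F ≡ sumBelow N G
sumBelow-cong zero    _   = refl
sumBelow-cong (suc N) F≡G = cong₂ _+_ (F≡G 0) (sumBelow-cong N (F≡G ∘ suc))

sumBelow-+ : ∀ N (F G : ℕ → ℕ) → sumBelow N (λ t → F t + G t) ≡ sumBelow N F + sumBelow N G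
sumBelow-+ zero    F G = refl
sumBelow-+ (suc N) F G = begin
  F 0 + G 0 + sumBelow N (λ t → F (suc t) + G (suc t))     ≡⟨ cong (F 0 + G 0 +_) (sumBelow-+ N (F ∘ suc) (G ∘ suc)) ⟩
  F 0 + G 0 + (sumBelow N (F ∘ suc) + sumBelow N (G ∘ suc)) ≡⟨ interchange (F 0) (G 0) _ _ ⟩
  F 0 + sumBelow N (F ∘ suc) + (G 0 + sumBelow N (G ∘ suc)) ∎
  where open ≡-Reasoning

sumBelow-*ʳ : ∀ N (F : ℕ → ℕ) c → sumBelow N (λ t → F t * c) ≡ sumBelow N F * c
sumBelow-*ʳ zero    F c = refl
sumBelow-*ʳ (suc N) F c = trans (cong (F 0 * c +_) (sumBelow-*ʳ N (F ∘ suc) c)) (sym (*-distribʳ-+ c (F 0) _))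

sumBelow-+ˡ : ∀ a c (F : ℕ → ℕ) → sumBelow (a + c) F ≡ sumBelow a F + sumBelow c (λ t → F (a + t))
sumBelow-+ˡ zero    c F = refl
sumBelow-+ˡ (suc a) c F = trans (cong (F 0 +_) (sumBelow-+ˡ a c (F ∘ suc))) (sym (+-assoc (F 0) _ _))

sumBelow-zero : ∀ N (F : ℕ → ℕ) → (∀ t → t < N → F t ≡ 0) → sumBelow N F ≡ 0
sumBelow-zero zero    F _  = refl
sumBelow-zero (suc N) F F0 = cong₂ _+_ (F0 0 z<s) (sumBelow-zero N (F ∘ suc) (λ t t<N → F0 (suc t) (s≤s t<N)))

count-< : ∀ N lo → sumBelow N (λ t → 𝟙 (t <? lo)) ≡ lo ⊓ N
count-< zero    lo       = sym (⊓-zeroʳ lo)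
count-< (suc N) zero     = sumBelow-zero (suc N) _ (λ t _ → 𝟙-no (t <? 0) (λ ()))
count-< (suc N) (suc lo) = cong suc (trans (sumBelow-cong N (λ t → 𝟙-cong (suc t <? suc lo) (t <? lo) s<s⁻¹ s<s)) (count-< N lo))

count-≥ : ∀ N hi → sumBelow N (λ t → 𝟙 (hi ≤? t)) ≡ N ∸ hi
count-≥ zero    zero     = refl
count-≥ zero    (suc hi) = refl
count-≥ (suc N) zero     = cong suc (trans (sumBelow-cong N (λ t → 𝟙-yes (0 ≤? suc t) z≤n)) (count-≥ N 0))
count-≥ (suc N) (suc hi) = trans (sumBelow-cong N (λ t → 𝟙-cong (suc hi ≤? suc t) (hi ≤? t) s≤s⁻¹ s≤s)) (count-≥ N hi)

sum-tabulate≤sumBelow : ∀ {A : Set} N (g : Fin N → A) (f : A → ℕ) (F : ℕ → ℕ) →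
                        (∀ i → f (g i) ≤ F (toℕ i)) → sum (map f (tabulate g)) ≤ sumBelow N F
sum-tabulate≤sumBelow zero    g f F _  = z≤n
sum-tabulate≤sumBelow (suc N) g f F fg≤F =
  +-mono-≤ (fg≤F fzero) (sum-tabulate≤sumBelow N (g ∘ fsuc) f (F ∘ suc) (fg≤F ∘ fsuc))

count≤length-filter : ∀ {A : Set} N (g : Fin N → A) {P : A → Set} (P? : Decidable P) {Q : ℕ → Set} (Q? : ∀ t → Dec (Q t)) →
                      (∀ i → Q (toℕ i) → P (g i)) → sumBelow N (λ t → 𝟙 (Q? t)) ≤ length (filter P? (tabulate g))
count≤length-filter zero    g P? Q? _   = z≤n
count≤length-filter (suc N) g P? Q? Q⇒P with P? (g fzero) | Q? 0
... | yes _ | yes _ = s≤s (count≤length-filter N (g ∘ fsuc) P? (Q? ∘ suc) (Q⇒P ∘ fsuc))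
... | yes _ | no _  = m≤n⇒m≤1+n (count≤length-filter N (g ∘ fsuc) P? (Q? ∘ suc) (Q⇒P ∘ fsuc))
... | no ¬p | yes q = contradiction (Q⇒P fzero q) ¬p
... | no _  | no _  = count≤length-filter N (g ∘ fsuc) P? (Q? ∘ suc) (Q⇒P ∘ fsuc)

-- Quantified over all decision procedures, since incidentColors filters with one that is private to Defs.
HasDegree≥ : ∀ {N} → SimpleGraph N → Fin N → ℕ → Set
HasDegree≥ {N} G v d = (D : Decidable (Adj G v)) → d ≤ length (filter D (allFin N))

listDef : List ℕ → ℕ
listDef []         = 0
listDef S@(_ ∷ _) = (maxL S ∸ minL S + 1) ∸ length S

vertexDef≡listDef : ∀ {N} (G : SimpleGraph N) (α : ProperEdgeColoring G) v → vertexDef G α v ≡ listDef (colorSet G α v)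
vertexDef≡listDef G α v with colorSet G α v
... | []    = refl
... | _ ∷ _ = refl

deduplicate-unique : ∀ {xs : List ℕ} → Unique xs → deduplicate _≟_ xs ≡ xs
deduplicate-unique {[]}     []         = refl
deduplicate-unique {x ∷ xs} (x∉ ∷ xs!) = cong (x ∷_) (trans (cong (filter (¬? ∘ (x ≟_))) (deduplicate-unique xs!)) (filter-all (¬? ∘ (x ≟_)) x∉))

maxL< : ∀ {h} x xs → x < h → All (_< h) xs → maxL (x ∷ xs) < h
maxL< x []       x<h []           = subst (_< _) (sym (⊔-identityʳ x)) x<h
maxL< x (y ∷ ys) x<h (y<h ∷ ys<h) = ⊔-lub x<h (maxL< y ys y<h ys<h)

≤minL : ∀ {lo} x xs → lo ≤ x → All (lo ≤_) xs → lo ≤ minL (x ∷ xs)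
≤minL x []       lo≤x []             = lo≤x
≤minL x (y ∷ ys) lo≤x (lo≤y ∷ lo≤ys) = ⊓-glb lo≤y (≤minL x ys lo≤x lo≤ys)

listDef≤ : ∀ lo w d (xs : List ℕ) → All (λ c → lo ≤ c × c < lo + w) xs → d ≤ length xs → listDef xs ≤ w ∸ d
listDef≤ lo w d []       _                         _ = z≤n
listDef≤ lo w d (x ∷ xs) in-range@((lo≤x , x<) ∷ _) d≤len = ∸-mono spread≤w d≤len
  where
  mx = maxL (x ∷ xs)
  mn = minL (x ∷ xs)
  spread<w : mx ∸ mn < w
  spread<w = begin-strict
    mx ∸ mn        ≤⟨ ∸-monoʳ-≤ mx (≤minL x xs lo≤x (All.map proj₁ (All.tail in-range))) ⟩
    mx ∸ lo        <⟨ ∸-monoˡ-< (maxL< x xs x< (All.map proj₂ (All.tail in-range))) (≤-trans lo≤x (m≤m⊔n x _)) ⟩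
    (lo + w) ∸ lo  ≡⟨ m+n∸m≡n lo w ⟩
    w              ∎
    where open ≤-Reasoning
  spread≤w : mx ∸ mn + 1 ≤ w
  spread≤w = subst (_≤ w) (+-comm 1 (mx ∸ mn)) spread<w

allPairs-restrict : ∀ {A : Set} {P : A → Set} {R S : A → A → Set} → (∀ {a c} → P a → P c → R a c → S a c) →
                    ∀ {xs} → All P xs → AllPairs R xs → AllPairs S xs
allPairs-restrict f []         []         = []
allPairs-restrict f (pa ∷ pas) (ra ∷ ras) = All.zipWith (λ (pc , r) → f pa pc r) (pas , ra) ∷ allPairs-restrict f pas ras

module _ {N : ℕ} (G : SimpleGraph N) (α : ProperEdgeColoring G) (v : Fin N) where

  incident-unique : (D : Decidable (Adj G v)) → Unique (map (col α v) (filter D (allFin N)))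
  incident-unique D = AllPairs.map⁺ (allPairs-restrict (λ vu vw u≢w → proper α v _ _ vu vw u≢w)
                        (all-filter D (allFin N)) (AllPairs.filter⁺ D (allFin⁺ N)))

  vertexDef≤ : ∀ lo w d → (∀ u → Adj G v u → lo ≤ col α v u × col α v u < lo + w) → HasDegree≥ G v d →
               vertexDef G α v ≤ w ∸ d
  vertexDef≤ lo w d in-range degree = begin
    vertexDef G α v                 ≡⟨ vertexDef≡listDef G α v ⟩
    listDef (colorSet G α v)        ≡⟨ cong listDef (deduplicate-unique (incident-unique _)) ⟩
    listDef (incidentColors G α v)  ≤⟨ bound _ ⟩
    w ∸ d                           ∎
    where
    open ≤-Reasoning
    bound : (D : Decidable (Adj G v)) → listDef (map (col α v) (filter D (allFin N))) ≤ w ∸ d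
    bound D = listDef≤ lo w d _ (AllP.map⁺ (All.map (λ {u} → in-range u) (all-filter D (allFin N))))
                (subst (d ≤_) (sym (length-map (col α v) (filter D (allFin N)))) (degree D))

-- Addition modulo an odd number

m+m≡n+n⇒m≡n : ∀ {m n} → m + m ≡ n + n → m ≡ n
m+m≡n+n⇒m≡n {m} {n} eq with <-cmp m n
... | tri< m<n _ _ = contradiction eq (<⇒≢ (+-mono-< m<n m<n))
... | tri≈ _ m≡n _ = m≡n
... | tri> _ _ n<m = contradiction (sym eq) (<⇒≢ (+-mono-< n<m n<m))

m+m≢1+n+n : ∀ m n → m + m ≢ suc (n + n)
m+m≢1+n+n zero    n       ()
m+m≢1+n+n (suc m) zero    eq = contradiction (trans (sym (+-suc m m)) (suc-injective eq)) λ ()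
m+m≢1+n+n (suc m) (suc n) eq = m+m≢1+n+n m n (trans (suc-injective (trans (sym (+-suc m m)) (suc-injective eq))) (+-suc n n))

[1+m+n]+[1+n+n]≡m+[1+n+n]+[1+n] : ∀ m n → suc (m + n) + suc (n + n) ≡ m + suc (n + n) + suc n
[1+m+n]+[1+n+n]≡m+[1+n+n]+[1+n] = solve-∀

m+[1+n+n]≡m+n+[1+n] : ∀ m n → m + suc (n + n) ≡ m + n + suc n
m+[1+n+n]≡m+n+[1+n] = solve-∀

m+m+[1+n+n]≡1+[m+n]+[m+n] : ∀ m n → m + m + suc (n + n) ≡ suc (m + n + (m + n))
m+m+[1+n+n]≡1+[m+n]+[m+n] = solve-∀

module ModularSum (m : ℕ) where
  M : ℕ
  M = suc (m + m)

  -- s mod M, correct only for s < 2 M; so u ⊕ v is addition modulo M for u, v < M.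
  reduce : ℕ → ℕ
  reduce s with s <? M
  ... | yes _ = s
  ... | no _ = s ∸ M

  infixl 6 _⊕_
  _⊕_ : ℕ → ℕ → ℕ
  u ⊕ v = reduce (u + v)

  data Reduced (s : ℕ) : ℕ → Set where
    below : s < M → Reduced s s
    above : (t : ℕ) → t + M ≡ s → Reduced s t

  reduce-view : ∀ s → Reduced s (reduce s)
  reduce-view s with s <? M
  ... | yes p = below p
  ... | no p = above (s ∸ M) (m∸n+n≡m (≮⇒≥ p))

  -- opp u = u + m + 1 mod M.  Just as u ≤ u ⊕ v exactly when v ≤ u ⊕ v, opp u ≤ u ⊕ v exactly when
  -- opp v ≤ u ⊕ v (opp≤⊕-sym); this is what keeps the shifted colouring symmetric.
  opp : ℕ → ℕ
  opp u with u ≤? m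
  ... | yes _ = suc (u + m)
  ... | no _ = u ∸ m

  data Opp (u : ℕ) : ℕ → Set where
    opp-low : u ≤ m → Opp u (suc (u + m))
    opp-high : (t : ℕ) → m < u → t + m ≡ u → Opp u t

  opp-view : ∀ u → Opp u (opp u)
  opp-view u with u ≤? m
  ... | yes p = opp-low p
  ... | no p = opp-high (u ∸ m) (≰⇒> p) (m∸n+n≡m (<⇒≤ (≰⇒> p)))

  shift : ℕ → ℕ → ℕ
  shift u k = 𝟙 (u ≤? k) + 𝟙 (opp u ≤? k)

  gapA gapB : ℕ → ℕ
  gapA u = 𝟙 (m <? u)
  gapB u = 𝟙 (u ≤? m)

  ⊕-comm : ∀ u v → u ⊕ v ≡ v ⊕ u
  ⊕-comm u v = cong reduce (+-comm u v)

  ⊕<M : ∀ u v → u < M → v < M → u ⊕ v < M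
  ⊕<M u v u<M v<M with reduce (u + v) | reduce-view (u + v)
  ... | .(u + v) | below p = p
  ... | t | above .t eq = +-cancelʳ-< M t M (subst (_< M + M) (sym eq) (+-mono-< u<M v<M))

  ≤⊕-sym : ∀ u v → v < M → u ≤ u ⊕ v → v ≤ u ⊕ v
  ≤⊕-sym u v v<M h with reduce (u + v) | reduce-view (u + v)
  ... | .(u + v) | below _ = m≤n+m v u
  ... | t | above .t eq = ⊥-elim (<⇒≱ v<M (+-cancelˡ-≤ u M v (subst (u + M ≤_) eq (+-monoˡ-≤ M h))))

  opp≤⊕-sym : ∀ u v → u < M → v < M → opp u ≤ u ⊕ v → opp v ≤ u ⊕ v
  opp≤⊕-sym u v u<M v<M h with reduce (u + v) | reduce-view (u + v) | opp u | opp-view u | opp v | opp-view v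
  ... | .(u + v) | below _ | _ | _ | t' | opp-high .t' _ eq' = ≤-trans (subst (t' ≤_) eq' (m≤m+n t' m)) (m≤n+m v u)
  ... | .(u + v) | below _ | .(suc (u + m)) | opp-low u≤m | .(suc (v + m)) | opp-low v≤m =
        ⊥-elim (<⇒≱ (s≤s v≤m) (+-cancelˡ-≤ u (suc m) v (subst (_≤ u + v) (sym (+-suc u m)) h)))
  ... | .(u + v) | below _ | t | opp-high .t m<u _ | .(suc (v + m)) | opp-low v≤m =
        subst₂ _≤_ (+-suc v m) (+-comm v u) (+-monoʳ-≤ v m<u)
  ... | w | above .w eqw | .(suc (u + m)) | opp-low u≤m | _ | _ =
        ⊥-elim (<⇒≱ v<M (+-cancelˡ-≤ u M v (m+n≤o⇒m≤o (u + M) (subst₂ _≤_ ([1+m+n]+[1+n+n]≡m+[1+n+n]+[1+n] u m) eqw (+-monoˡ-≤ M h)))))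
  ... | w | above .w eqw | t | opp-high .t m<u eq | .(suc (v + m)) | opp-low v≤m =
        ⊥-elim (<⇒≱ (s≤s v≤m) (+-cancelˡ-≤ u (suc m) v (subst₂ _≤_ (trans (m+[1+n+n]≡m+n+[1+n] t m) (cong (_+ suc m) eq)) eqw (+-monoˡ-≤ M h))))
  ... | w | above .w eqw | t | opp-high .t m<u eq | t' | opp-high .t' m<v eq' =
        +-cancelʳ-≤ M t' w (subst₂ _≤_ (sym (trans (m+[1+n+n]≡m+n+[1+n] t' m) (cong (_+ suc m) eq'))) (trans (+-comm v u) (sym eqw)) (+-monoʳ-≤ v m<u))

  shift-sym : ∀ u v → u < M → v < M → shift u (u ⊕ v) ≡ shift v (u ⊕ v)
  shift-sym u v u<M v<M = cong₂ _+_
    (𝟙-cong (u ≤? u ⊕ v) (v ≤? u ⊕ v) (≤⊕-sym u v v<M) (flipped (≤⊕-sym v u u<M)))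
    (𝟙-cong (opp u ≤? u ⊕ v) (opp v ≤? u ⊕ v) (opp≤⊕-sym u v u<M v<M) (flipped (opp≤⊕-sym v u v<M u<M)))
    where
    flipped : ∀ {x y} → (x ≤ v ⊕ u → y ≤ v ⊕ u) → x ≤ u ⊕ v → y ≤ u ⊕ v
    flipped f = subst (_ ≤_) (⊕-comm v u) ∘ f ∘ subst (_ ≤_) (⊕-comm u v)

  shift-mono : ∀ u {k k'} → k ≤ k' → shift u k ≤ shift u k'
  shift-mono u {k} {k'} k≤k' =
    +-mono-≤ (𝟙-mono (u ≤? k) (u ≤? k') (λ u≤k → ≤-trans u≤k k≤k')) (𝟙-mono (opp u ≤? k) (opp u ≤? k') (λ opp≤k → ≤-trans opp≤k k≤k'))

  shift≤2 : ∀ u k → shift u k ≤ 2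
  shift≤2 u k = +-mono-≤ (𝟙≤1 (u ≤? k)) (𝟙≤1 (opp u ≤? k))

  shift-double : ∀ u → u < M → shift u (u ⊕ u) ≡ 1
  shift-double u u<M with reduce (u + u) | reduce-view (u + u) | opp u | opp-view u
  ... | .(u + u) | below _ | .(suc (u + m)) | opp-low u≤m =
        cong₂ _+_ (𝟙-yes (u ≤? u + u) (m≤m+n u u))
                  (𝟙-no (suc (u + m) ≤? u + u) (λ h → <⇒≱ (s≤s u≤m) (+-cancelˡ-≤ u (suc m) u (subst (_≤ u + u) (sym (+-suc u m)) h))))
  ... | .(u + u) | below p | t | opp-high .t m<u _ = ⊥-elim (<⇒≱ p (+-mono-≤ m<u (<⇒≤ m<u)))
  ... | w | above .w eqw | .(suc (u + m)) | opp-low u≤m =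
        ⊥-elim (<⇒≱ (s≤s (+-mono-≤ u≤m u≤m)) (subst (M ≤_) eqw (m≤n+m M w)))
  ... | w | above .w eqw | t | opp-high .t m<u eq =
        cong₂ _+_ (𝟙-no (u ≤? w) (λ h → <⇒≱ u<M (+-cancelˡ-≤ u M u (subst (u + M ≤_) eqw (+-monoˡ-≤ M h)))))
                  (𝟙-yes (t ≤? w) (+-cancelʳ-≤ M t w (subst₂ _≤_ (sym (trans (m+[1+n+n]≡m+n+[1+n] t m) (cong (_+ suc m) eq))) (sym eqw) (+-monoʳ-≤ u m<u))))

  double-injective : ∀ u u' → u < M → u' < M → u ⊕ u ≡ u' ⊕ u' → u ≡ u'
  double-injective u u' u<M u'<M e with reduce (u + u) | reduce-view (u + u) | reduce (u' + u') | reduce-view (u' + u')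
  ... | .(u + u) | below _ | .(u' + u') | below _ = m+m≡n+n⇒m≡n e
  ... | .(u + u) | below p | w | above .w eqw = ⊥-elim (m+m≢1+n+n u' (u + m) (sym (trans (sym (m+m+[1+n+n]≡1+[m+n]+[m+n] u m)) (trans (cong (_+ M) e) eqw))))
  ... | w | above .w eqw | .(u' + u') | below p = ⊥-elim (m+m≢1+n+n u (u' + m) (sym (trans (sym (m+m+[1+n+n]≡1+[m+n]+[m+n] u' m)) (trans (cong (_+ M) (sym e)) eqw))))
  ... | w | above .w eqw | w' | above .w' eqw' = m+m≡n+n⇒m≡n (trans (sym eqw) (trans (cong (_+ M) e) eqw'))

  ⊕-cancelˡ : ∀ u v v' → v < M → v' < M → u ⊕ v ≡ u ⊕ v' → v ≡ v'
  ⊕-cancelˡ u v v' v<M v'<M e with reduce (u + v) | reduce-view (u + v) | reduce (u + v') | reduce-view (u + v')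
  ... | .(u + v) | below _ | .(u + v') | below _ = +-cancelˡ-≡ u v v' e
  ... | .(u + v) | below _ | w | above .w eqw = ⊥-elim (<⇒≱ v'<M (+-cancelˡ-≤ u M v' (subst (u + M ≤_) (trans (cong (_+ M) e) eqw) (+-monoˡ-≤ M (m≤m+n u v)))))
  ... | w | above .w eqw | .(u + v') | below _ = ⊥-elim (<⇒≱ v<M (+-cancelˡ-≤ u M v (subst (u + M ≤_) (trans (cong (_+ M) (sym e)) eqw) (+-monoˡ-≤ M (m≤m+n u v')))))
  ... | w | above .w eqw | w' | above .w' eqw' = +-cancelˡ-≡ u v v' (trans (sym eqw) (trans (cong (_+ M) e) eqw'))

  ⊕-identityʳ : ∀ u → u < M → u ⊕ 0 ≡ u
  ⊕-identityʳ u u<M with reduce (u + 0) | reduce-view (u + 0)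
  ... | .(u + 0) | below _ = +-identityʳ u
  ... | w | above .w eqw = ⊥-elim (<⇒≱ u<M (subst (M ≤_) (trans eqw (+-identityʳ u)) (m≤n+m M w)))

  opp-positive : ∀ u → 1 ≤ opp u
  opp-positive u with opp u | opp-view u
  ... | .(suc (u + m)) | opp-low _ = s≤s z≤n
  ... | t | opp-high .t m<u eq = +-cancelʳ-≤ m 1 t (subst (suc m ≤_) (sym eq) m<u)

  opp≤M : ∀ u → u < M → opp u ≤ M
  opp≤M u u<M with opp u | opp-view u
  ... | .(suc (u + m)) | opp-low u≤m = s≤s (+-monoˡ-≤ m u≤m)
  ... | t | opp-high .t m<u eq = ≤-trans (m≤m+n t m) (subst (_≤ M) (sym eq) (<⇒≤ u<M))

  <opp : ∀ u → u ≤ m → u < opp u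
  <opp u u≤m with opp u | opp-view u
  ... | .(suc (u + m)) | opp-low _ = s≤s (m≤m+n u m)
  ... | t | opp-high .t m<u eq = ⊥-elim (<⇒≱ m<u u≤m)

  opp< : ∀ u → m < u → u < M → opp u < u
  opp< u m<u u<M with opp u | opp-view u
  ... | .(suc (u + m)) | opp-low u≤m = ⊥-elim (<⇒≱ m<u u≤m)
  ... | t | opp-high .t _ eq = subst (t <_) eq (subst (_≤ t + m) (+-comm t 1) (+-monoʳ-≤ t 1≤m))
    where
    1≤m : 1 ≤ m
    1≤m = +-cancelˡ-< m 0 m (subst (_< m + m) (sym (+-identityʳ m)) (<-≤-trans m<u (≤-pred u<M)))

  opp≤m : ∀ u → m < u → u < M → opp u ≤ m
  opp≤m u m<u u<M with opp u | opp-view u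
  ... | .(suc (u + m)) | opp-low u≤m = ⊥-elim (<⇒≱ m<u u≤m)
  ... | t | opp-high .t _ eq = +-cancelʳ-≤ m t m (subst (_≤ m + m) (sym eq) (≤-pred u<M))

  opp>m : ∀ u → u ≤ m → m < opp u
  opp>m u u≤m with opp u | opp-view u
  ... | .(suc (u + m)) | opp-low _ = s≤s (m≤n+m m u)
  ... | t | opp-high .t m<u eq = ⊥-elim (<⇒≱ m<u u≤m)

  opp-injective : ∀ u u' → u < M → u' < M → opp u ≡ opp u' → u ≡ u'
  opp-injective u u' u<M u'<M e with opp u | opp-view u | opp u' | opp-view u'
  ... | .(suc (u + m)) | opp-low _ | .(suc (u' + m)) | opp-low _ = +-cancelʳ-≡ m u u' (suc-injective e)
  ... | t | opp-high .t _ eq | t' | opp-high .t' _ eq' = trans (sym eq) (trans (cong (_+ m) e) eq')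
  ... | .(suc (u + m)) | opp-low _ | t | opp-high .t _ eq' =
        ⊥-elim (<⇒≱ (s≤s (m≤n+m m u)) (subst (_≤ m) (sym e) (+-cancelʳ-≤ m t m (subst (_≤ m + m) (sym eq') (≤-pred u'<M)))))
  ... | t | opp-high .t _ eq | .(suc (u' + m)) | opp-low _ =
        ⊥-elim (<⇒≱ (s≤s (m≤n+m m u')) (subst (_≤ m) e (+-cancelʳ-≤ m t m (subst (_≤ m + m) (sym eq) (≤-pred u<M)))))

  shift-self : ∀ u → u < M → shift u u ≡ suc (gapA u)
  shift-self u u<M = cong₂ _+_ (𝟙-yes (u ≤? u) ≤-refl)
    (𝟙-cong (opp u ≤? u) (m <? u) (λ h → ≰⇒> (λ u≤m → <⇒≱ (<opp u u≤m) h)) (λ m<u → <⇒≤ (opp< u m<u u<M)))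

  shift-opp : ∀ u → u < M → shift u (opp u) ≡ suc (gapB u)
  shift-opp u u<M = trans (cong₂ _+_
    (𝟙-cong (u ≤? opp u) (u ≤? m) (λ h → ≮⇒≥ (λ m<u → <⇒≱ (opp< u m<u u<M) h)) (λ u≤m → <⇒≤ (<opp u u≤m)))
    (𝟙-yes (opp u ≤? opp u) ≤-refl)) (+-comm (gapB u) 1)

  gapA-mono : ∀ {u u'} → u ≤ u' → gapA u ≤ gapA u'
  gapA-mono {u} {u'} u≤u' = 𝟙-mono (m <? u) (m <? u') (λ h → <-≤-trans h u≤u')

  gapB-mono : ∀ u u' → u' < M → opp u < opp u' → gapB u ≤ gapB u'
  gapB-mono u u' u'<M lt = 𝟙-mono (u ≤? m) (u' ≤? m) (λ u≤m → ≮⇒≥ (λ m<u' → <⇒≱ (<-trans (opp>m u u≤m) lt) (opp≤m u' m<u' u'<M)))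

  ⊕-positive : ∀ u v → 1 ≤ u → u + v ≢ M → 1 ≤ u ⊕ v
  ⊕-positive u v 1≤u ne with reduce (u + v) | reduce-view (u + v)
  ... | .(u + v) | below _ = ≤-trans 1≤u (m≤m+n u v)
  ... | zero | above .zero eq = ⊥-elim (ne (sym eq))
  ... | suc w | above .(suc w) eq = s≤s z≤n

  double-positive : ∀ u → u < M → 1 ≤ u → 1 ≤ u ⊕ u
  double-positive u u<M 1≤u with u ⊕ u ≟ 0
  ... | no ne = n≢0⇒n>0 ne
  ... | yes e = ⊥-elim (<⇒≢ 1≤u (sym (double-injective u 0 u<M (s≤s z≤n) e)))

module Blocks (m b : ℕ) where
  open ModularSum m

  -- In row u, block k of colours starts at pos u k; the unit gaps slotA u and slotB u are left just before
  -- blocks u and opp u.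
  pos : ℕ → ℕ → ℕ
  pos u k = b * k + shift u k

  slotA slotB : ℕ → ℕ
  slotA u = b * u + gapA u
  slotB u = b * opp u + gapB u

  block-< : ∀ {ξ₁ ξ₂ k₁ k₂ s₁ s₂} → ξ₁ < b → k₁ < k₂ → s₁ ≤ s₂ → ξ₁ + (b * k₁ + s₁) < ξ₂ + (b * k₂ + s₂)
  block-< {ξ₁} {ξ₂} {k₁} {k₂} {s₁} {s₂} ξ₁<b k₁<k₂ s₁≤s₂ = begin-strict
    ξ₁ + (b * k₁ + s₁)  <⟨ +-monoˡ-< (b * k₁ + s₁) ξ₁<b ⟩
    b + (b * k₁ + s₁)   ≡⟨ sym (+-assoc b (b * k₁) s₁) ⟩
    b + b * k₁ + s₁     ≡⟨ cong (_+ s₁) (sym (*-suc b k₁)) ⟩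
    b * suc k₁ + s₁     ≤⟨ +-mono-≤ (*-monoʳ-≤ b k₁<k₂) s₁≤s₂ ⟩
    b * k₂ + s₂         ≤⟨ m≤n+m (b * k₂ + s₂) ξ₂ ⟩
    ξ₂ + (b * k₂ + s₂)  ∎
    where open ≤-Reasoning

  block-injective : ∀ {ξ₁ ξ₂ k₁ k₂ s₁ s₂} → ξ₁ < b → ξ₂ < b → (k₁ < k₂ → s₁ ≤ s₂) → (k₂ < k₁ → s₂ ≤ s₁) →
                    ξ₁ + (b * k₁ + s₁) ≡ ξ₂ + (b * k₂ + s₂) → k₁ ≡ k₂
  block-injective {ξ₁} {ξ₂} {k₁} {k₂} ξ₁<b ξ₂<b mono₁₂ mono₂₁ eq with <-cmp k₁ k₂
  ... | tri< k₁<k₂ _ _ = contradiction eq (<⇒≢ (block-< {ξ₂ = ξ₂} ξ₁<b k₁<k₂ (mono₁₂ k₁<k₂)))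
  ... | tri≈ _ k₁≡k₂ _ = k₁≡k₂
  ... | tri> _ _ k₂<k₁ = contradiction (sym eq) (<⇒≢ (block-< {ξ₂ = ξ₁} ξ₂<b k₂<k₁ (mono₂₁ k₂<k₁)))

  pos-injective : ∀ u {ξ₁ ξ₂ k₁ k₂} → ξ₁ < b → ξ₂ < b → ξ₁ + pos u k₁ ≡ ξ₂ + pos u k₂ → k₁ ≡ k₂ × ξ₁ ≡ ξ₂
  pos-injective u {ξ₁} {ξ₂} {k₁} ξ₁<b ξ₂<b eq =
    k₁≡k₂ , +-cancelʳ-≡ (pos u k₁) ξ₁ ξ₂ (trans eq (cong (λ k → ξ₂ + pos u k) (sym k₁≡k₂)))
    where
    k₁≡k₂ = block-injective ξ₁<b ξ₂<b (shift-mono u ∘ <⇒≤) (shift-mono u ∘ <⇒≤) eq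

  pos≢slotA : ∀ u k {ξ} → ξ < b → u < M → ξ + pos u k ≢ slotA u
  pos≢slotA u k {ξ} ξ<b u<M eq with k <? u
  ... | yes k<u = <-irrefl eq (block-< {ξ₂ = 0} ξ<b k<u (subst (_≤ gapA u) (sym (cong (_+ 𝟙 (opp u ≤? k)) (𝟙-no (u ≤? k) (<⇒≱ k<u))))
                    (𝟙-mono (opp u ≤? k) (m <? u) (λ opp≤k → ≰⇒> (λ u≤m → <⇒≱ (<-≤-trans k<u (<⇒≤ (<opp u u≤m))) opp≤k)))))
  ... | no k≮u = <-irrefl (sym eq) (begin-strict
    b * u + gapA u        <⟨ +-monoʳ-< (b * u) (n<1+n (gapA u)) ⟩
    b * u + suc (gapA u)  ≡⟨ cong (b * u +_) (sym (shift-self u u<M)) ⟩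
    b * u + shift u u     ≤⟨ +-mono-≤ (*-monoʳ-≤ b (≮⇒≥ k≮u)) (shift-mono u (≮⇒≥ k≮u)) ⟩
    b * k + shift u k     ≤⟨ m≤n+m _ ξ ⟩
    ξ + pos u k           ∎)
    where open ≤-Reasoning

  pos≢slotB : ∀ u k {ξ} → ξ < b → u < M → ξ + pos u k ≢ slotB u
  pos≢slotB u k {ξ} ξ<b u<M eq with k <? opp u
  ... | yes k<opp = <-irrefl eq (block-< {ξ₂ = 0} ξ<b k<opp
                      (≤-trans (≤-reflexive (trans (cong (𝟙 (u ≤? k) +_) (𝟙-no (opp u ≤? k) (<⇒≱ k<opp))) (+-identityʳ _)))
                      (𝟙-mono (u ≤? k) (u ≤? m) (λ u≤k → ≮⇒≥ (λ m<u → <⇒≱ (opp< u m<u u<M) (≤-trans u≤k (<⇒≤ k<opp)))))))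
  ... | no k≮opp = <-irrefl (sym eq) (begin-strict
    b * opp u + gapB u           <⟨ +-monoʳ-< (b * opp u) (n<1+n (gapB u)) ⟩
    b * opp u + suc (gapB u)     ≡⟨ cong (b * opp u +_) (sym (shift-opp u u<M)) ⟩
    b * opp u + shift u (opp u)  ≤⟨ +-mono-≤ (*-monoʳ-≤ b (≮⇒≥ k≮opp)) (shift-mono u (≮⇒≥ k≮opp)) ⟩
    b * k + shift u k            ≤⟨ m≤n+m _ ξ ⟩
    ξ + pos u k                  ∎)
    where open ≤-Reasoning

  slotA≢slotB : ∀ u → u < M → slotA u ≢ slotB u
  slotA≢slotB u u<M eq with m <? u
  ... | no m≮u  = <-irrefl eq (begin-strict
    b * u + 0           ≡⟨ +-identityʳ _ ⟩
    b * u               ≤⟨ *-monoʳ-≤ b (<⇒≤ (<opp u (≮⇒≥ m≮u))) ⟩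
    b * opp u           <⟨ m<m+n _ z<s ⟩
    b * opp u + 1       ≡⟨ cong (b * opp u +_) (sym (𝟙-yes (u ≤? m) (≮⇒≥ m≮u))) ⟩
    b * opp u + gapB u  ∎)
    where open ≤-Reasoning
  ... | yes m<u = <-irrefl (sym eq) (begin-strict
    b * opp u + gapB u  ≡⟨ trans (cong (b * opp u +_) (𝟙-no (u ≤? m) (<⇒≱ m<u))) (+-identityʳ _) ⟩
    b * opp u           ≤⟨ *-monoʳ-≤ b (<⇒≤ (opp< u m<u u<M)) ⟩
    b * u               <⟨ m<m+n _ z<s ⟩
    b * u + 1           ∎)
    where open ≤-Reasoning

  pos-sym : ∀ {u v} → u < M → v < M → pos u (u ⊕ v) ≡ pos v (v ⊕ u)
  pos-sym {u} {v} u<M v<M =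
    cong₂ _+_ (cong (b *_) (⊕-comm u v)) (trans (shift-sym u v u<M v<M) (cong (shift v) (⊕-comm u v)))

  staircase-injective : (K S : ℕ → ℕ) → (∀ x y → x < M → y < M → K x < K y → S x ≤ S y) →
                        (∀ x y → x < M → y < M → K x ≡ K y → x ≡ y) →
                        ∀ {u₁ u₂ ξ₁ ξ₂} → u₁ < M → u₂ < M → ξ₁ < b → ξ₂ < b →
                        ξ₁ + (b * K u₁ + S u₁) ≡ ξ₂ + (b * K u₂ + S u₂) → u₁ ≡ u₂ × ξ₁ ≡ ξ₂
  staircase-injective K S S-mono K-injective {u₁} {u₂} {ξ₁} {ξ₂} u₁<M u₂<M ξ₁<b ξ₂<b eq =
    u₁≡u₂ , +-cancelʳ-≡ (b * K u₁ + S u₁) ξ₁ ξ₂ (trans eq (cong (λ u → ξ₂ + (b * K u + S u)) (sym u₁≡u₂)))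
    where
    u₁≡u₂ : u₁ ≡ u₂
    u₁≡u₂ = K-injective u₁ u₂ u₁<M u₂<M
              (block-injective ξ₁<b ξ₂<b (S-mono u₁ u₂ u₁<M u₂<M) (S-mono u₂ u₁ u₂<M u₁<M) eq)

-- The blown-up colouring

-- vtx u ξ is copy ξ of vertex u of K_M; diag ξ is joined to every vtx u _ by the colour u ⊕ u missing at u;
-- origin ξ is a copy of vertex 0 of K_M placed in the big part; poleA and poleB fill the gaps slotA and slotB.
data Hub : Set where
  diag origin : ℕ → Hub
  poleA poleB : Hub

data Role : Set where
  vtx : ℕ → ℕ → Role
  hub : Hub → Role

module BlownUp (m b k0 : ℕ) where
  open ModularSum m public
  open Blocks m b public

  hubSlot : ℕ → Hub → ℕ
  hubSlot u (diag ξ)   = ξ + pos u (u ⊕ u)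
  hubSlot u (origin ξ) = ξ + pos u (u ⊕ 0)
  hubSlot u poleA      = slotA u
  hubSlot u poleB      = slotB u

  slot : ℕ → Role → ℕ
  slot u (vtx u' ξ') = ξ' + pos u (u ⊕ u')
  slot u (hub h)     = hubSlot u h

  colour : Role → Role → ℕ
  colour (vtx u ξ) R         = suc (ξ + slot u R)
  colour (hub h)   (vtx u ξ) = suc (ξ + hubSlot u h)
  colour (hub _)   (hub _)   = 1

  Valid : Role → Set
  Valid (vtx u ξ)        = k0 ≤ u × u < M × ξ < b
  Valid (hub (diag ξ))   = ξ < b
  Valid (hub (origin ξ)) = 1 ≤ k0 × ξ < b
  Valid (hub poleA)      = ⊤
  Valid (hub poleB)      = ⊤

  Joined : Role → Role → Set
  Joined (vtx u _) (vtx u' _) = u ≢ u' × k0 ≤ u ⊕ u'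
  Joined (hub _)   (hub _)    = ⊥
  Joined _         _          = ⊤

  colour-sym : ∀ R R' → Valid R → Valid R' → colour R R' ≡ colour R' R
  colour-sym (vtx u ξ) (vtx u' ξ') (_ , u<M , _) (_ , u'<M , _) = cong suc (begin
    ξ + (ξ' + pos u (u ⊕ u'))   ≡⟨ cong (λ p → ξ + (ξ' + p)) (pos-sym u<M u'<M) ⟩
    ξ + (ξ' + pos u' (u' ⊕ u))  ≡⟨ x∙yz≈y∙xz ξ ξ' _ ⟩
    ξ' + (ξ + pos u' (u' ⊕ u))  ∎)
    where open ≡-Reasoning
  colour-sym (vtx u ξ) (hub h)   _ _ = refl
  colour-sym (hub h)   (vtx u ξ) _ _ = refl
  colour-sym (hub h)   (hub h')  _ _ = refl

  colour-positive : ∀ R R' → 1 ≤ colour R R'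
  colour-positive (vtx _ _) _         = s≤s z≤n
  colour-positive (hub _)   (vtx _ _) = s≤s z≤n
  colour-positive (hub _)   (hub _)   = s≤s z≤n

  origin-apart : ∀ {u} → k0 ≤ u → 1 ≤ k0 → u ≢ 0
  origin-apart k0≤u 1≤k0 refl = <⇒≱ 1≤k0 k0≤u

  vtx-slot≢hubSlot : ∀ {u u' ξ'} h → u < M → Valid (vtx u' ξ') → Valid (hub h) → u ≢ u' →
                     ξ' + pos u (u ⊕ u') ≢ hubSlot u h
  vtx-slot≢hubSlot {u} {u'} (diag ξ)   u<M (_ , u'<M , ξ'<b) ξ<b u≢u' eq =
    u≢u' (sym (⊕-cancelˡ u u' u u'<M u<M (proj₁ (pos-injective u ξ'<b ξ<b eq))))
  vtx-slot≢hubSlot {u} {u'} (origin ξ) u<M (k0≤u' , u'<M , ξ'<b) (1≤k0 , ξ<b) _ eq =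
    origin-apart k0≤u' 1≤k0 (⊕-cancelˡ u u' 0 u'<M z<s (proj₁ (pos-injective u ξ'<b ξ<b eq)))
  vtx-slot≢hubSlot {u} poleA u<M (_ , _ , ξ'<b) _ _ = pos≢slotA u _ ξ'<b u<M
  vtx-slot≢hubSlot {u} poleB u<M (_ , _ , ξ'<b) _ _ = pos≢slotB u _ ξ'<b u<M

  hubSlot-injective : ∀ {u} h h' → k0 ≤ u → u < M → Valid (hub h) → Valid (hub h') → hubSlot u h ≡ hubSlot u h' → h ≡ h'
  hubSlot-injective {u} (diag ξ)   (diag ξ')   _    u<M ξ<b ξ'<b eq = cong diag (proj₂ (pos-injective u ξ<b ξ'<b eq))
  hubSlot-injective {u} (diag ξ)   (origin ξ') k0≤u u<M ξ<b (1≤k0 , ξ'<b) eq =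
    contradiction (⊕-cancelˡ u u 0 u<M z<s (proj₁ (pos-injective u ξ<b ξ'<b eq))) (origin-apart k0≤u 1≤k0)
  hubSlot-injective {u} (diag ξ)   poleA       _ u<M ξ<b _ eq = contradiction eq (pos≢slotA u _ ξ<b u<M)
  hubSlot-injective {u} (diag ξ)   poleB       _ u<M ξ<b _ eq = contradiction eq (pos≢slotB u _ ξ<b u<M)
  hubSlot-injective {u} (origin ξ) (diag ξ')   k0≤u u<M vh vh' eq = sym (hubSlot-injective (diag ξ') (origin ξ) k0≤u u<M vh' vh (sym eq))
  hubSlot-injective {u} (origin ξ) (origin ξ') _ u<M (_ , ξ<b) (_ , ξ'<b) eq = cong origin (proj₂ (pos-injective u ξ<b ξ'<b eq))
  hubSlot-injective {u} (origin ξ) poleA       _ u<M (_ , ξ<b) _ eq = contradiction eq (pos≢slotA u _ ξ<b u<M)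
  hubSlot-injective {u} (origin ξ) poleB       _ u<M (_ , ξ<b) _ eq = contradiction eq (pos≢slotB u _ ξ<b u<M)
  hubSlot-injective {u} poleA      (diag ξ')   _ u<M _ ξ'<b eq = contradiction (sym eq) (pos≢slotA u _ ξ'<b u<M)
  hubSlot-injective {u} poleA      (origin ξ') _ u<M _ (_ , ξ'<b) eq = contradiction (sym eq) (pos≢slotA u _ ξ'<b u<M)
  hubSlot-injective {u} poleA      poleA       _ _   _ _ _ = refl
  hubSlot-injective {u} poleA      poleB       _ u<M _ _ eq = contradiction eq (slotA≢slotB u u<M)
  hubSlot-injective {u} poleB      (diag ξ')   _ u<M _ ξ'<b eq = contradiction (sym eq) (pos≢slotB u _ ξ'<b u<M)
  hubSlot-injective {u} poleB      (origin ξ') _ u<M _ (_ , ξ'<b) eq = contradiction (sym eq) (pos≢slotB u _ ξ'<b u<M)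
  hubSlot-injective {u} poleB      poleA       _ u<M _ _ eq = contradiction (sym eq) (slotA≢slotB u u<M)
  hubSlot-injective {u} poleB      poleB       _ _   _ _ _ = refl

  slot-injective : ∀ {u ξ} R R' → Valid (vtx u ξ) → Valid R → Valid R' → Joined (vtx u ξ) R → Joined (vtx u ξ) R' →
                   slot u R ≡ slot u R' → R ≡ R'
  slot-injective {u} (vtx u₁ ξ₁) (vtx u₂ ξ₂) (_ , u<M , _) (_ , u₁<M , ξ₁<b) (_ , u₂<M , ξ₂<b) _ _ eq =
    let (k₁≡k₂ , ξ₁≡ξ₂) = pos-injective u ξ₁<b ξ₂<b eq
    in  cong₂ vtx (⊕-cancelˡ u u₁ u₂ u₁<M u₂<M k₁≡k₂) ξ₁≡ξ₂
  slot-injective (vtx u₁ ξ₁) (hub h) (_ , u<M , _) v₁ vh (u≢u₁ , _) _ eq = ⊥-elim (vtx-slot≢hubSlot h u<M v₁ vh u≢u₁ eq)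
  slot-injective (hub h) (vtx u₂ ξ₂) (_ , u<M , _) vh v₂ _ (u≢u₂ , _) eq = ⊥-elim (vtx-slot≢hubSlot h u<M v₂ vh u≢u₂ (sym eq))
  slot-injective (hub h) (hub h') (k0≤u , u<M , _) vh vh' _ _ eq = cong hub (hubSlot-injective h h' k0≤u u<M vh vh' eq)

  hub-colour-injective : ∀ h {u₁ u₂ ξ₁ ξ₂} → Valid (hub h) → Valid (vtx u₁ ξ₁) → Valid (vtx u₂ ξ₂) →
                         ξ₁ + hubSlot u₁ h ≡ ξ₂ + hubSlot u₂ h → vtx u₁ ξ₁ ≡ vtx u₂ ξ₂
  hub-colour-injective h {u₁} {u₂} {ξ₁} {ξ₂} vh (_ , u₁<M , ξ₁<b) (_ , u₂<M , ξ₂<b) eq = uncurry (cong₂ vtx) (by-hub h eq)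
    where
    staircase : (K S : ℕ → ℕ) → (∀ x y → x < M → y < M → K x < K y → S x ≤ S y) → (∀ x y → x < M → y < M → K x ≡ K y → x ≡ y) →
                ξ₁ + (b * K u₁ + S u₁) ≡ ξ₂ + (b * K u₂ + S u₂) → u₁ ≡ u₂ × ξ₁ ≡ ξ₂
    staircase K S S-mono K-injective = staircase-injective K S S-mono K-injective u₁<M u₂<M ξ₁<b ξ₂<b
    cancel-copy : ∀ {ξ p₁ p₂} → ξ₁ + (ξ + p₁) ≡ ξ₂ + (ξ + p₂) → ξ₁ + p₁ ≡ ξ₂ + p₂
    cancel-copy {ξ} {p₁} {p₂} e = +-cancelˡ-≡ ξ _ _ (trans (x∙yz≈y∙xz ξ ξ₁ p₁) (trans e (x∙yz≈y∙xz ξ₂ ξ p₂)))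
    by-hub : ∀ h → ξ₁ + hubSlot u₁ h ≡ ξ₂ + hubSlot u₂ h → u₁ ≡ u₂ × ξ₁ ≡ ξ₂
    by-hub (diag ξ) e = staircase (λ u → u ⊕ u) (λ u → shift u (u ⊕ u))
      (λ x y x<M y<M _ → ≤-reflexive (trans (shift-double x x<M) (sym (shift-double y y<M))))
      double-injective (cancel-copy {ξ} e)
    by-hub (origin ξ) e = staircase (λ u → u ⊕ 0) (λ u → shift u (u ⊕ 0))
      (λ x y x<M y<M lt → subst₂ _≤_ (shift-at-self x x<M) (shift-at-self y y<M)
        (s≤s (gapA-mono (<⇒≤ (subst₂ _<_ (⊕-identityʳ x x<M) (⊕-identityʳ y y<M) lt)))))
      (λ x y x<M y<M e → trans (sym (⊕-identityʳ x x<M)) (trans e (⊕-identityʳ y y<M)))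
      (cancel-copy {ξ} e)
      where
      shift-at-self : ∀ u → u < M → suc (gapA u) ≡ shift u (u ⊕ 0)
      shift-at-self u u<M = trans (sym (shift-self u u<M)) (cong (shift u) (sym (⊕-identityʳ u u<M)))
    by-hub poleA e = staircase (λ u → u) gapA (λ _ _ _ _ lt → gapA-mono (<⇒≤ lt)) (λ _ _ _ _ e → e) e
    by-hub poleB e = staircase opp gapB (λ x y _ y<M lt → gapB-mono x y y<M lt) opp-injective e

  colour-injective : ∀ R R₁ R₂ → Valid R → Valid R₁ → Valid R₂ → Joined R R₁ → Joined R R₂ →
                     colour R R₁ ≡ colour R R₂ → R₁ ≡ R₂
  colour-injective (vtx u ξ) R₁ R₂ v v₁ v₂ j₁ j₂ eq =
    slot-injective R₁ R₂ v v₁ v₂ j₁ j₂ (+-cancelˡ-≡ ξ _ _ (suc-injective eq))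
  colour-injective (hub h) (vtx u₁ ξ₁) (vtx u₂ ξ₂) vh v₁ v₂ _ _ eq = hub-colour-injective h vh v₁ v₂ (suc-injective eq)

  lowest highest : Role → ℕ
  lowest (vtx u ξ)         = suc (ξ + b * k0)
  lowest (hub (diag ξ))    = suc (suc (ξ + b * k0))
  lowest (hub (origin ξ))  = suc (suc (ξ + b * k0))
  lowest (hub poleA)       = suc (b * k0)
  lowest (hub poleB)       = suc b
  highest (vtx u ξ)        = suc (ξ + suc (b * M))
  highest (hub (diag ξ))   = suc (ξ + b * M)
  highest (hub (origin ξ)) = suc (suc (ξ + b * M))
  highest (hub poleA)      = suc (b * M)
  highest (hub poleB)      = suc (b * M + b)

  block-end : ∀ {ξ k} → ξ < b → k < M → suc (ξ + b * k) ≤ b * M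
  block-end {ξ} {k} ξ<b k<M = begin
    suc (ξ + b * k)  ≤⟨ +-monoˡ-≤ (b * k) ξ<b ⟩
    b + b * k        ≡⟨ sym (*-suc b k) ⟩
    b * suc k        ≤⟨ *-monoʳ-≤ b k<M ⟩
    b * M            ∎
    where open ≤-Reasoning

  b*≤offset : ∀ {j ξ k s} → j ≤ k → b * j ≤ ξ + (b * k + s)
  b*≤offset {ξ = ξ} {k} {s} j≤k = ≤-trans (*-monoʳ-≤ b j≤k) (≤-trans (m≤m+n (b * k) s) (m≤n+m _ ξ))

  offset≤b*M : ∀ {ξ k e} → ξ < b → k < M → e ≤ 1 → ξ + (b * k + e) ≤ b * M
  offset≤b*M {ξ} {k} {e} ξ<b k<M e≤1 = begin
    ξ + (b * k + e)  ≤⟨ +-monoʳ-≤ ξ (+-monoʳ-≤ (b * k) e≤1) ⟩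
    ξ + (b * k + 1)  ≡⟨ trans (sym (+-assoc ξ (b * k) 1)) (+-comm (ξ + b * k) 1) ⟩
    suc (ξ + b * k)  ≤⟨ block-end ξ<b k<M ⟩
    b * M            ∎
    where open ≤-Reasoning

  offset≤1+b*M : ∀ {ξ k s} → ξ < b → k < M → s ≤ 2 → ξ + (b * k + s) ≤ suc (b * M)
  offset≤1+b*M {ξ} {k} {s} ξ<b k<M s≤2 = s≤s⁻¹ (begin
    suc (ξ + (b * k + s))  ≡⟨ cong suc (sym (+-assoc ξ (b * k) s)) ⟩
    suc (ξ + b * k) + s    ≤⟨ +-mono-≤ (block-end ξ<b k<M) s≤2 ⟩
    b * M + 2              ≡⟨ +-comm (b * M) 2 ⟩
    suc (suc (b * M))      ∎)
    where open ≤-Reasoning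

  block+gap≤1+b*M : ∀ {k e} → k ≤ M → e ≤ 1 → b * k + e ≤ suc (b * M)
  block+gap≤1+b*M {k} {e} k≤M e≤1 = subst (b * k + e ≤_) (+-comm (b * M) 1) (+-mono-≤ (*-monoʳ-≤ b k≤M) e≤1)

  floor≤double : k0 ≤ 1 → ∀ {u} → k0 ≤ u → u < M → k0 ≤ u ⊕ u
  floor≤double z≤n       _    _   = z≤n
  floor≤double (s≤s z≤n) 1≤u u<M = double-positive _ u<M 1≤u

  slot-range : k0 ≤ 1 → ∀ {u ξ} R → Valid (vtx u ξ) → Valid R → Joined (vtx u ξ) R → b * k0 ≤ slot u R × slot u R ≤ suc (b * M)
  slot-range _    {u} (vtx u' ξ')       (_ , u<M , _) (_ , u'<M , ξ'<b) (_ , k0≤k) =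
    b*≤offset {ξ = ξ'} k0≤k , offset≤1+b*M ξ'<b (⊕<M u u' u<M u'<M) (shift≤2 u _)
  slot-range k0≤1 {u} (hub (diag ξ'))   (k0≤u , u<M , _) ξ'<b _ =
    b*≤offset {ξ = ξ'} (floor≤double k0≤1 k0≤u u<M) , offset≤1+b*M ξ'<b (⊕<M u u u<M u<M) (shift≤2 u _)
  slot-range _    {u} (hub (origin ξ')) (k0≤u , u<M , _) (_ , ξ'<b) _ =
    b*≤offset {ξ = ξ'} (subst (k0 ≤_) (sym (⊕-identityʳ u u<M)) k0≤u) , offset≤1+b*M ξ'<b (⊕<M u 0 u<M z<s) (shift≤2 u _)
  slot-range _    {u} (hub poleA)       (k0≤u , u<M , _) _ _ =
    b*≤offset {ξ = 0} k0≤u , block+gap≤1+b*M (<⇒≤ u<M) (𝟙≤1 (m <? u))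
  slot-range k0≤1 {u} (hub poleB)       (_ , u<M , _) _ _ =
    b*≤offset {ξ = 0} (≤-trans k0≤1 (opp-positive u)) , block+gap≤1+b*M (opp≤M u u<M) (𝟙≤1 (u ≤? m))

  hub-colour-range : k0 ≤ 1 → ∀ h {u ξ'} → Valid (hub h) → Valid (vtx u ξ') →
                     lowest (hub h) ≤ colour (hub h) (vtx u ξ') × colour (hub h) (vtx u ξ') ≤ highest (hub h)
  hub-colour-range k0≤1 (diag ξ) {u} {ξ'} _ (k0≤u , u<M , ξ'<b) rewrite shift-double u u<M =
    s≤s (begin
      suc (ξ + b * k0)              ≤⟨ s≤s (+-monoʳ-≤ ξ (*-monoʳ-≤ b (floor≤double k0≤1 k0≤u u<M))) ⟩
      suc (ξ + b * (u ⊕ u))         ≡⟨ sym (trans (sym (+-assoc ξ _ 1)) (+-comm _ 1)) ⟩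
      ξ + (b * (u ⊕ u) + 1)         ≤⟨ m≤n+m _ ξ' ⟩
      ξ' + (ξ + (b * (u ⊕ u) + 1))  ∎) ,
    s≤s (begin
      ξ' + (ξ + (b * (u ⊕ u) + 1))  ≡⟨ x∙yz≈y∙xz ξ' ξ _ ⟩
      ξ + (ξ' + (b * (u ⊕ u) + 1))  ≤⟨ +-monoʳ-≤ ξ (offset≤b*M ξ'<b (⊕<M u u u<M u<M) ≤-refl) ⟩
      ξ + b * M                     ∎)
    where open ≤-Reasoning
  hub-colour-range _ (origin ξ) {u} {ξ'} _ (k0≤u , u<M , ξ'<b) rewrite ⊕-identityʳ u u<M | shift-self u u<M =
    s≤s (begin
      suc (ξ + b * k0)                  ≤⟨ s≤s (+-monoʳ-≤ ξ (*-monoʳ-≤ b k0≤u)) ⟩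
      suc (ξ + b * u)                   ≡⟨ sym (trans (sym (+-assoc ξ _ 1)) (+-comm _ 1)) ⟩
      ξ + (b * u + 1)                   ≤⟨ +-monoʳ-≤ ξ (+-monoʳ-≤ (b * u) (s≤s z≤n)) ⟩
      ξ + (b * u + suc (gapA u))        ≤⟨ m≤n+m _ ξ' ⟩
      ξ' + (ξ + (b * u + suc (gapA u))) ∎) ,
    s≤s (begin
      ξ' + (ξ + (b * u + suc (gapA u))) ≡⟨ x∙yz≈y∙xz ξ' ξ _ ⟩
      ξ + (ξ' + (b * u + suc (gapA u))) ≡⟨ cong (λ z → ξ + (ξ' + z)) (+-suc (b * u) (gapA u)) ⟩
      ξ + (ξ' + suc (b * u + gapA u))   ≡⟨ cong (ξ +_) (+-suc ξ' _) ⟩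
      ξ + suc (ξ' + (b * u + gapA u))   ≤⟨ +-monoʳ-≤ ξ (s≤s (offset≤b*M ξ'<b u<M (𝟙≤1 (m <? u)))) ⟩
      ξ + suc (b * M)                   ≡⟨ +-suc ξ _ ⟩
      suc (ξ + b * M)                   ∎)
    where open ≤-Reasoning
  hub-colour-range _ poleA {u} {ξ'} _ (k0≤u , u<M , ξ'<b) =
    s≤s (b*≤offset {ξ = ξ'} k0≤u) , s≤s (offset≤b*M ξ'<b u<M (𝟙≤1 (m <? u)))
  hub-colour-range _ poleB {u} {ξ'} _ (_ , u<M , ξ'<b) =
    s≤s (subst (_≤ ξ' + slotB u) (*-identityʳ b) (b*≤offset {ξ = ξ'} (opp-positive u))) ,
    s≤s (begin
      ξ' + (b * opp u + gapB u)  ≤⟨ +-monoʳ-≤ ξ' (+-monoʳ-≤ (b * opp u) (𝟙≤1 (u ≤? m))) ⟩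
      ξ' + (b * opp u + 1)       ≡⟨ trans (sym (+-assoc ξ' (b * opp u) 1)) (+-comm (ξ' + b * opp u) 1) ⟩
      suc (ξ' + b * opp u)       ≤⟨ +-monoˡ-≤ (b * opp u) ξ'<b ⟩
      b + b * opp u              ≤⟨ +-monoʳ-≤ b (*-monoʳ-≤ b (opp≤M u u<M)) ⟩
      b + b * M                  ≡⟨ +-comm b (b * M) ⟩
      b * M + b                  ∎)
    where open ≤-Reasoning

  colour-range : k0 ≤ 1 → ∀ R R' → Valid R → Valid R' → Joined R R' → lowest R ≤ colour R R' × colour R R' ≤ highest R
  colour-range k0≤1 (vtx u ξ) R' v v' j =
    let (lo≤ , ≤hi) = slot-range k0≤1 R' v v' j in s≤s (+-monoʳ-≤ ξ lo≤) , s≤s (+-monoʳ-≤ ξ ≤hi)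
  colour-range k0≤1 (hub h) (vtx u ξ') vh v' _ = hub-colour-range k0≤1 h vh v'

-- The complete multipartite graph

module Multipartite (n r : ℕ) .{{_ : NonZero n}} where
  N : ℕ
  N = n * r + (n + 2)

  G : SimpleGraph N
  G = Kpart n r

  part : ℕ → ℕ
  part = partOf n r

  part-small : ∀ {t} → t < n * r → part t ≡ t / n
  part-small {t} t<nr with t <ᵇ n * r | <⇒<ᵇ t<nr
  ... | true | _ = refl

  part-big : ∀ {t} → n * r ≤ t → part t ≡ r
  part-big {t} nr≤t with t <ᵇ n * r in eq
  ... | true  = contradiction nr≤t (<⇒≱ (<ᵇ⇒< t (n * r) (subst T (sym eq) tt)))
  ... | false = refl

  Adj⇒part≢ : ∀ v w → Adj G v w → part (toℕ v) ≢ part (toℕ w)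
  Adj⇒part≢ v w vw eq with part (toℕ v) ≡ᵇ part (toℕ w) | ≡⇒≡ᵇ (part (toℕ v)) (part (toℕ w)) eq
  Adj⇒part≢ v w () eq | true  | _
  Adj⇒part≢ v w vw eq | false | ()

  part≢⇒Adj : ∀ v w → part (toℕ v) ≢ part (toℕ w) → Adj G v w
  part≢⇒Adj v w ≢ with part (toℕ v) ≡ᵇ part (toℕ w) in eq
  ... | true  = contradiction (≡ᵇ⇒≡ (part (toℕ v)) (part (toℕ w)) (subst T (sym eq) tt)) ≢
  ... | false = refl

  big-independent : ∀ v w → n * r ≤ toℕ v → n * r ≤ toℕ w → ¬ Adj G v w
  big-independent v w nr≤v nr≤w vw = Adj⇒part≢ v w vw (trans (part-big nr≤v) (sym (part-big nr≤w)))

  quotient<r : ∀ {t} → t < n * r → t / n < r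
  quotient<r {t} t<nr = m<n*o⇒m/o<n (subst (t <_) (*-comm n r) t<nr)

  count-outside : ∀ lo hi → lo ≤ hi → hi ≤ N → lo + (N ∸ hi) ≤ sumBelow N (λ t → 𝟙 (t <? lo ⊎-dec hi ≤? t))
  count-outside lo hi lo≤hi hi≤N = begin
    lo + (N ∸ hi)
      ≡⟨ cong₂ _+_ (sym (trans (count-< N lo) (m≤n⇒m⊓n≡m (≤-trans lo≤hi hi≤N)))) (sym (count-≥ N hi)) ⟩
    sumBelow N (λ t → 𝟙 (t <? lo)) + sumBelow N (λ t → 𝟙 (hi ≤? t)) ≡⟨ sym (sumBelow-+ N _ _) ⟩
    sumBelow N (λ t → 𝟙 (t <? lo) + 𝟙 (hi ≤? t))                 ≤⟨ sumBelow-mono N disjoint ⟩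
    sumBelow N (λ t → 𝟙 (t <? lo ⊎-dec hi ≤? t))                 ∎
    where
    open ≤-Reasoning
    disjoint : ∀ t → 𝟙 (t <? lo) + 𝟙 (hi ≤? t) ≤ 𝟙 (t <? lo ⊎-dec hi ≤? t)
    disjoint t with t <? lo | hi ≤? t
    ... | yes t<lo | yes hi≤t = contradiction hi≤t (<⇒≱ (<-≤-trans t<lo lo≤hi))
    ... | yes _    | no _     = ≤-refl
    ... | no _     | yes _    = ≤-refl
    ... | no _     | no _     = z≤n

  small-degree : ∀ v → toℕ v < n * r → HasDegree≥ G v (n * r + 2)
  small-degree v v<nr D = begin
    n * r + 2                                      ≡⟨ sym outside-size ⟩
    lo + (N ∸ hi)                                  ≤⟨ count-outside lo hi (m≤m+n lo n) hi≤N ⟩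
    sumBelow N (λ t → 𝟙 (t <? lo ⊎-dec hi ≤? t))  ≤⟨ count≤length-filter N (λ x → x) D (λ t → t <? lo ⊎-dec hi ≤? t) outside⇒Adj ⟩
    length (filter D (allFin N))                   ∎
    where
    open ≤-Reasoning
    i = toℕ v / n
    lo = i * n
    hi = lo + n
    i<r : i < r
    i<r = quotient<r v<nr
    hi≤N : hi ≤ N
    hi≤N = ≤-trans (subst₂ _≤_ (+-comm n lo) (*-comm r n) (*-monoˡ-≤ n i<r)) (m≤m+n (n * r) (n + 2))
    outside-size : lo + (N ∸ hi) ≡ n * r + 2
    outside-size = +-cancelʳ-≡ n _ _ (begin-equality
      lo + (N ∸ hi) + n    ≡⟨ xy∙z≈xz∙y lo _ n ⟩
      hi + (N ∸ hi)        ≡⟨ m+[n∸m]≡n hi≤N ⟩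
      N                    ≡⟨ cong (n * r +_) (+-comm n 2) ⟩
      n * r + (2 + n)      ≡⟨ sym (+-assoc (n * r) 2 n) ⟩
      n * r + 2 + n        ∎)
    outside⇒Adj : ∀ w → (toℕ w < lo ⊎ hi ≤ toℕ w) → Adj G v w
    outside⇒Adj w outside = part≢⇒Adj v w (λ eq → other-part outside (trans (sym (part-small v<nr)) eq))
      where
      other-part : (toℕ w < lo ⊎ hi ≤ toℕ w) → i ≢ part (toℕ w)
      other-part _ eq with toℕ w <? n * r
      ... | no w≮nr = <-irrefl (trans eq (part-big (≮⇒≥ w≮nr))) i<r
      other-part (inj₁ w<lo) eq | yes w<nr = <-irrefl (sym (trans eq (part-small w<nr)))
                            (*-cancelʳ-< n _ i (≤-<-trans (m/n*n≤m (toℕ w) n) w<lo))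
      other-part (inj₂ hi≤w) eq | yes w<nr = <-irrefl (trans eq (part-small w<nr))
                            (subst (_≤ toℕ w / n) (m*n/n≡m (suc i) n) (/-monoˡ-≤ n (subst (_≤ toℕ w) (+-comm lo n) hi≤w)))

  big-degree : ∀ v → n * r ≤ toℕ v → HasDegree≥ G v (n * r)
  big-degree v nr≤v D = begin
    n * r                             ≡⟨ sym (trans (count-< N (n * r)) (m≤n⇒m⊓n≡m (m≤m+n (n * r) (n + 2)))) ⟩
    sumBelow N (λ t → 𝟙 (t <? n * r)) ≤⟨ count≤length-filter N (λ x → x) D (λ t → t <? n * r) small⇒Adj ⟩
    length (filter D (allFin N))      ∎
    where
    open ≤-Reasoning
    small⇒Adj : ∀ w → toℕ w < n * r → Adj G v w
    small⇒Adj w w<nr = part≢⇒Adj v w (λ eq → <-irrefl (trans (sym (part-small w<nr)) (trans (sym eq) (part-big nr≤v))) (quotient<r w<nr))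

  degreeLB : ℕ → ℕ
  degreeLB t with t <? n * r
  ... | yes _ = n * r + 2
  ... | no _  = n * r

  hasDegree≥degreeLB : ∀ v → HasDegree≥ G v (degreeLB (toℕ v))
  hasDegree≥degreeLB v with toℕ v <? n * r
  ... | yes v<nr = small-degree v v<nr
  ... | no v≮nr  = big-degree v (≮⇒≥ v≮nr)

vtx-constructor-injective : ∀ {u u' ξ ξ'} → vtx u ξ ≡ vtx u' ξ' → u ≡ u' × ξ ≡ ξ'
vtx-constructor-injective refl = refl , refl

hub-constructor-injective : ∀ {h h'} → hub h ≡ hub h' → h ≡ h'
hub-constructor-injective refl = refl

module RoleColouring
  (n r m b k0 : ℕ) .{{_ : NonZero n}} (k0≤1 : k0 ≤ 1) (b*M≡b*k0+n*r : b * suc (m + m) ≡ b * k0 + n * r)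
  (baseOf copyOf : ℕ → ℕ) (hubOf : ℕ → Hub)
  (vtx-valid : ∀ {t} → t < n * r → BlownUp.Valid m b k0 (vtx (baseOf t) (copyOf t)))
  (hub-valid : ∀ {y} → y < n + 2 → BlownUp.Valid m b k0 (hub (hubOf y)))
  (vtx-injective : ∀ {t t'} → t < n * r → t' < n * r → baseOf t ≡ baseOf t' → copyOf t ≡ copyOf t' → t ≡ t')
  (hub-injective : ∀ {y y'} → y < n + 2 → y' < n + 2 → hubOf y ≡ hubOf y' → y ≡ y')
  (parts-joined : ∀ {t t'} → t < n * r → t' < n * r → t / n ≢ t' / n →
                  BlownUp.Joined m b k0 (vtx (baseOf t) (copyOf t)) (vtx (baseOf t') (copyOf t')))
  where

  open BlownUp m b k0
  open Multipartite n r

  role : ℕ → Role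
  role t with t <? n * r
  ... | yes _ = vtx (baseOf t) (copyOf t)
  ... | no _  = hub (hubOf (t ∸ n * r))

  big-index< : ∀ {t} → t < N → ¬ t < n * r → t ∸ n * r < n + 2
  big-index< {t} t<N t≮nr = subst (t ∸ n * r <_) (m+n∸m≡n (n * r) (n + 2)) (∸-monoˡ-< t<N (≮⇒≥ t≮nr))

  role-valid : ∀ v → Valid (role (toℕ v))
  role-valid v with toℕ v <? n * r
  ... | yes v<nr = vtx-valid v<nr
  ... | no v≮nr  = hub-valid (big-index< (toℕ<n v) v≮nr)

  role-injective : ∀ v w → role (toℕ v) ≡ role (toℕ w) → v ≡ w
  role-injective v w eq with toℕ v <? n * r | toℕ w <? n * r
  ... | yes v<nr | yes w<nr = toℕ-injective (uncurry (vtx-injective v<nr w<nr) (vtx-constructor-injective eq))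
  ... | no v≮nr  | no w≮nr  = toℕ-injective (begin
    toℕ v                      ≡⟨ sym (m∸n+n≡m (≮⇒≥ v≮nr)) ⟩
    toℕ v ∸ n * r + n * r      ≡⟨ cong (_+ n * r) (hub-injective (big-index< (toℕ<n v) v≮nr) (big-index< (toℕ<n w) w≮nr)
                                                                  (hub-constructor-injective eq)) ⟩
    toℕ w ∸ n * r + n * r      ≡⟨ m∸n+n≡m (≮⇒≥ w≮nr) ⟩
    toℕ w                      ∎)
    where open ≡-Reasoning
  role-injective v w () | yes _ | no _
  role-injective v w () | no _  | yes _

  role-joined : ∀ v w → Adj G v w → Joined (role (toℕ v)) (role (toℕ w))
  role-joined v w vw with toℕ v <? n * r | toℕ w <? n * r
  ... | yes v<nr | yes w<nr = parts-joined v<nr w<nr (λ eq → Adj⇒part≢ v w vw (trans (part-small v<nr) (trans eq (sym (part-small w<nr)))))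
  ... | yes _    | no _     = tt
  ... | no _     | yes _    = tt
  ... | no v≮nr  | no w≮nr  = big-independent v w (≮⇒≥ v≮nr) (≮⇒≥ w≮nr) vw

  α : ProperEdgeColoring G
  α = record
    { col     = λ v w → colour (role (toℕ v)) (role (toℕ w))
    ; col-sym = λ v w _ → colour-sym _ _ (role-valid v) (role-valid w)
    ; col-pos = λ v w _ → colour-positive _ _
    ; proper  = λ u v w uv uw v≢w eq → v≢w (role-injective v w
        (colour-injective _ _ _ (role-valid u) (role-valid v) (role-valid w) (role-joined u v uv) (role-joined u w uw) eq))
    }

  width : Role → ℕ
  width (vtx _ _)        = n * r + 2
  width (hub (diag _))   = n * r
  width (hub (origin _)) = suc (n * r)
  width (hub poleA)      = suc (n * r)
  width (hub poleB)      = suc (b * k0 + n * r)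

  highest-width : ∀ R → suc (highest R) ≡ lowest R + width R
  highest-width (vtx _ ξ)        rewrite b*M≡b*k0+n*r = vtx-width ξ (b * k0) (n * r)
    where
    vtx-width : ∀ ξ x s → suc (suc (ξ + suc (x + s))) ≡ suc (ξ + x) + (s + 2)
    vtx-width = solve-∀
  highest-width (hub (diag ξ))   rewrite b*M≡b*k0+n*r = diag-width ξ (b * k0) (n * r)
    where
    diag-width : ∀ ξ x s → suc (suc (ξ + (x + s))) ≡ suc (suc (ξ + x)) + s
    diag-width = solve-∀
  highest-width (hub (origin ξ)) rewrite b*M≡b*k0+n*r = origin-width ξ (b * k0) (n * r)
    where
    origin-width : ∀ ξ x s → suc (suc (suc (ξ + (x + s)))) ≡ suc (suc (ξ + x)) + suc s
    origin-width = solve-∀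
  highest-width (hub poleA)      rewrite b*M≡b*k0+n*r = sym (+-suc (suc (b * k0)) (n * r))
  highest-width (hub poleB)      rewrite b*M≡b*k0+n*r = poleB-width (b * k0) (n * r) b
    where
    poleB-width : ∀ x s b → suc (suc (x + s + b)) ≡ suc b + suc (x + s)
    poleB-width = solve-∀

  role-def : ℕ → ℕ
  role-def t = width (role t) ∸ degreeLB t

  vertexDef≤role-def : ∀ v → vertexDef G α v ≤ role-def (toℕ v)
  vertexDef≤role-def v = vertexDef≤ G α v (lowest R) (width R) (degreeLB (toℕ v)) colours-in-range (hasDegree≥degreeLB v)
    where
    R = role (toℕ v)
    colours-in-range : ∀ w → Adj G v w → lowest R ≤ col α v w × col α v w < lowest R + width R
    colours-in-range w vw =
      let (lo≤c , c≤hi) = colour-range k0≤1 R (role (toℕ w)) (role-valid v) (role-valid w) (role-joined v w vw)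
      in  lo≤c , subst (col α v w <_) (highest-width R) (s≤s c≤hi)

  hubDef : Hub → ℕ
  hubDef (diag _)   = 0
  hubDef (origin _) = 1
  hubDef poleA      = 1
  hubDef poleB      = suc (b * k0)

  role-def-small : ∀ t → t < n * r → role-def t ≡ 0
  role-def-small t t<nr with t <? n * r
  ... | yes _    = n∸n≡0 (n * r + 2)
  ... | no t≮nr  = contradiction t<nr t≮nr

  role-def-big : ∀ y → role-def (n * r + y) ≡ hubDef (hubOf y)
  role-def-big y with n * r + y <? n * r
  ... | yes nr+y<nr = contradiction (m≤m+n (n * r) y) (<⇒≱ nr+y<nr)
  ... | no _ rewrite m+n∸m≡n (n * r) y = hub-width (hubOf y)
    where
    hub-width : ∀ h → width (hub h) ∸ n * r ≡ hubDef h
    hub-width (diag _)   = n∸n≡0 (n * r)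
    hub-width (origin _) = m+n∸n≡m 1 (n * r)
    hub-width poleA      = m+n∸n≡m 1 (n * r)
    hub-width poleB      = m+n∸n≡m (suc (b * k0)) (n * r)

  totalDef≤ : totalDef G α ≤ sumBelow (n + 2) (hubDef ∘ hubOf)
  totalDef≤ = begin
    totalDef G α
      ≤⟨ sum-tabulate≤sumBelow N (λ v → v) (vertexDef G α) role-def vertexDef≤role-def ⟩
    sumBelow N role-def
      ≡⟨ sumBelow-+ˡ (n * r) (n + 2) role-def ⟩
    sumBelow (n * r) role-def + sumBelow (n + 2) (λ y → role-def (n * r + y))
      ≡⟨ cong₂ _+_ (sumBelow-zero (n * r) role-def role-def-small) (sumBelow-cong (n + 2) role-def-big) ⟩
    sumBelow (n + 2) (hubDef ∘ hubOf)
      ∎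
    where open ≤-Reasoning

-- The two parity cases

/-%-injective : ∀ {t t'} n .{{_ : NonZero n}} → t / n ≡ t' / n → t % n ≡ t' % n → t ≡ t'
/-%-injective {t} {t'} n q≡ r≡ = begin
  t                   ≡⟨ m≡m%n+[m/n]*n t n ⟩
  t % n + t / n * n   ≡⟨ cong₂ (λ x y → x + y * n) r≡ q≡ ⟩
  t' % n + t' / n * n ≡⟨ sym (m≡m%n+[m/n]*n t' n) ⟩
  t'                  ∎
  where open ≡-Reasoning

<2+⇒≤1+ : ∀ {y n} → y < n + 2 → y ≤ suc n
<2+⇒≤1+ {y} {n} y<n+2 = s≤s⁻¹ (subst (y <_) (+-comm n 2) y<n+2)

module OddParts (n m : ℕ) .{{_ : NonZero n}} where
  r : ℕ
  r = suc (m + m)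

  open BlownUp m n 0 using (Valid; Joined)
  open Multipartite n r using (quotient<r)

  hubOf : ℕ → Hub
  hubOf y with y <? n
  ... | yes _ = diag y
  ... | no _ with y ≟ n
  ...   | yes _ = poleA
  ...   | no _  = poleB

  hubIndex : Hub → ℕ
  hubIndex (diag ξ)   = ξ
  hubIndex (origin ξ) = ξ
  hubIndex poleA      = n
  hubIndex poleB      = suc n

  hubIndex-hubOf : ∀ {y} → y < n + 2 → hubIndex (hubOf y) ≡ y
  hubIndex-hubOf {y} y<n+2 with y <? n
  ... | yes _ = refl
  ... | no y≮n with y ≟ n
  ...   | yes y≡n = sym y≡n
  ...   | no y≢n  = ≤-antisym (≤∧≢⇒< (≮⇒≥ y≮n) (y≢n ∘ sym)) (<2+⇒≤1+ y<n+2)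

  hubOf-valid : ∀ {y} → y < n + 2 → Valid (hub (hubOf y))
  hubOf-valid {y} _ with y <? n
  ... | yes y<n = y<n
  ... | no _ with y ≟ n
  ...   | yes _ = tt
  ...   | no _  = tt

  open RoleColouring n r m n 0 z≤n (cong (_+ n * r) (sym (*-zeroʳ n)))
         (_/ n) (_% n) hubOf
         (λ t<nr → z≤n , quotient<r t<nr , m%n<n _ n)
         hubOf-valid
         (λ _ _ → /-%-injective n)
         (λ y< y'< eq → trans (sym (hubIndex-hubOf y<)) (trans (cong hubIndex eq) (hubIndex-hubOf y'<)))
         (λ _ _ q≢q' → q≢q' , z≤n)

  hubDef≤ : ∀ y → hubDef (hubOf y) ≤ 𝟙 (n ≤? y)
  hubDef≤ y with y <? n
  ... | yes _ = z≤n
  ... | no y≮n with y ≟ n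
  ...   | yes _ = ≤-reflexive (sym (𝟙-yes (n ≤? y) (≮⇒≥ y≮n)))
  ...   | no _  = subst₂ _≤_ (cong suc (sym (*-zeroʳ n))) (sym (𝟙-yes (n ≤? y) (≮⇒≥ y≮n))) ≤-refl

  deficiency≤ : DefAtMost (Kpart n r) (n * r + 2)
  deficiency≤ = α , (begin
    totalDef (Kpart n r) α                ≤⟨ totalDef≤ ⟩
    sumBelow (n + 2) (hubDef ∘ hubOf)     ≤⟨ sumBelow-mono (n + 2) hubDef≤ ⟩
    sumBelow (n + 2) (λ y → 𝟙 (n ≤? y))   ≡⟨ count-≥ (n + 2) n ⟩
    n + 2 ∸ n                             ≡⟨ m+n∸m≡n n 2 ⟩
    2                                     ≤⟨ m≤n+m 2 (n * r) ⟩
    n * r + 2                             ∎)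
    where open ≤-Reasoning

module EvenParts (b r : ℕ) .{{_ : NonZero (b + b)}} (1≤r : 1 ≤ r) where
  n : ℕ
  n = b + b

  open BlownUp r b 1 using (Valid; Joined; M; _⊕_; ⊕-positive)
  open Multipartite n r using (quotient<r)

  i≤r+r : ∀ {i} → i < r → i ≤ r + r
  i≤r+r i<r = ≤-trans (<⇒≤ i<r) (m≤m+n r r)

  1+r≤r+r∸i : ∀ {i} → i < r → suc r ≤ (r + r) ∸ i
  1+r≤r+r∸i {i} i<r = m+n≤o⇒m≤o∸n (suc r) (subst (_≤ r + r) (+-suc r i) (+-monoʳ-≤ r i<r))

  ∸b<b : ∀ {x} → b ≤ x → x < b + b → x ∸ b < b
  ∸b<b {x} b≤x x<2b = +-cancelʳ-< b (x ∸ b) b (subst (_< b + b) (sym (m∸n+n≡m b≤x)) x<2b)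

  baseOf copyOf : ℕ → ℕ
  baseOf t with t % n <? b
  ... | yes _ = suc (t / n)
  ... | no _  = (r + r) ∸ (t / n)
  copyOf t with t % n <? b
  ... | yes _ = t % n
  ... | no _  = t % n ∸ b

  vtx-valid : ∀ {t} → t < n * r → Valid (vtx (baseOf t) (copyOf t))
  vtx-valid {t} t<nr with t % n <? b
  ... | yes first-half = s≤s z≤n , s≤s (≤-trans (quotient<r t<nr) (m≤m+n r r)) , first-half
  ... | no second-half = ≤-trans (s≤s z≤n) (1+r≤r+r∸i (quotient<r t<nr)) , s≤s (m∸n≤m (r + r) (t / n)) ,
                         ∸b<b (≮⇒≥ second-half) (m%n<n t n)

  vtxIndex : ℕ → ℕ → ℕ
  vtxIndex u ξ with u ≤? r
  ... | yes _ = ξ + pred u * n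
  ... | no _  = ξ + b + ((r + r) ∸ u) * n

  vtxIndex-baseOf : ∀ {t} → t < n * r → vtxIndex (baseOf t) (copyOf t) ≡ t
  vtxIndex-baseOf {t} t<nr with t % n <? b
  ... | yes _ with suc (t / n) ≤? r
  ...   | yes _      = sym (m≡m%n+[m/n]*n t n)
  ...   | no 1+q≰r   = contradiction (quotient<r t<nr) 1+q≰r
  vtxIndex-baseOf {t} t<nr | no second-half with (r + r) ∸ (t / n) ≤? r
  ...   | yes mirror≤r = contradiction mirror≤r (<⇒≱ (1+r≤r+r∸i (quotient<r t<nr)))
  ...   | no _ rewrite m∸n+n≡m (≮⇒≥ second-half) | m∸[m∸n]≡n (i≤r+r (quotient<r t<nr)) = sym (m≡m%n+[m/n]*n t n)

  mirror-same-part : ∀ {i i'} → i < r → i' < r → suc i + ((r + r) ∸ i') ≡ M → i' ≡ i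
  mirror-same-part {i} {i'} i<r i'<r eq =
    ∸-cancelˡ-≡ (i≤r+r i'<r) (i≤r+r i<r) (trans (sym (m+n∸m≡n i _)) (cong (_∸ i) (suc-injective eq)))

  other-part-apart : ∀ {t t'} → t < n * r → t' < n * r → t / n ≢ t' / n → baseOf t ≢ baseOf t' × baseOf t + baseOf t' ≢ M
  other-part-apart {t} {t'} t<nr t'<nr q≢q' with t % n <? b | t' % n <? b
  ... | yes _ | yes _ = (q≢q' ∘ suc-injective) ,
                        (λ eq → <-irrefl eq (s≤s (+-mono-≤ (quotient<r t<nr) (quotient<r t'<nr))))
  ... | no _  | no _  = (q≢q' ∘ ∸-cancelˡ-≡ (i≤r+r (quotient<r t<nr)) (i≤r+r (quotient<r t'<nr))) ,
                        (λ eq → <-irrefl (sym eq) (≤-trans (≤-reflexive (cong suc (sym (+-suc r r))))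
                                  (+-mono-≤ (1+r≤r+r∸i (quotient<r t<nr)) (1+r≤r+r∸i (quotient<r t'<nr)))))
  ... | yes _ | no _  = (λ eq → <⇒≱ (quotient<r t<nr) (s≤s⁻¹ (≤-trans (1+r≤r+r∸i (quotient<r t'<nr)) (≤-reflexive (sym eq))))) ,
                        (λ eq → q≢q' (sym (mirror-same-part (quotient<r t<nr) (quotient<r t'<nr) eq)))
  ... | no _  | yes _ = (λ eq → <⇒≱ (quotient<r t'<nr) (s≤s⁻¹ (≤-trans (1+r≤r+r∸i (quotient<r t<nr)) (≤-reflexive eq)))) ,
                        (λ eq → q≢q' (mirror-same-part (quotient<r t'<nr) (quotient<r t<nr) (trans (+-comm (suc (t' / n)) _) eq)))

  parts-joined : ∀ {t t'} → t < n * r → t' < n * r → t / n ≢ t' / n → Joined (vtx (baseOf t) (copyOf t)) (vtx (baseOf t') (copyOf t'))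
  parts-joined t<nr t'<nr q≢q' =
    let (u≢u' , u+u'≢M) = other-part-apart t<nr t'<nr q≢q'
    in  u≢u' , ⊕-positive _ _ (proj₁ (vtx-valid t<nr)) u+u'≢M

  hubOf : ℕ → Hub
  hubOf y with y <? b
  ... | yes _ = diag y
  ... | no _ with y <? n
  ...   | yes _ = origin (y ∸ b)
  ...   | no _ with y ≟ n
  ...     | yes _ = poleA
  ...     | no _  = poleB

  hubIndex : Hub → ℕ
  hubIndex (diag ξ)   = ξ
  hubIndex (origin ξ) = ξ + b
  hubIndex poleA      = n
  hubIndex poleB      = suc n

  hubIndex-hubOf : ∀ {y} → y < n + 2 → hubIndex (hubOf y) ≡ y
  hubIndex-hubOf {y} y<n+2 with y <? b
  ... | yes _ = refl
  ... | no y≮b with y <? n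
  ...   | yes _ = m∸n+n≡m (≮⇒≥ y≮b)
  ...   | no y≮n with y ≟ n
  ...     | yes y≡n = sym y≡n
  ...     | no y≢n  = ≤-antisym (≤∧≢⇒< (≮⇒≥ y≮n) (y≢n ∘ sym)) (<2+⇒≤1+ y<n+2)

  hubOf-valid : ∀ {y} → y < n + 2 → Valid (hub (hubOf y))
  hubOf-valid {y} _ with y <? b
  ... | yes y<b = y<b
  ... | no y≮b with y <? n
  ...   | yes y<n = s≤s z≤n , ∸b<b (≮⇒≥ y≮b) y<n
  ...   | no _ with y ≟ n
  ...     | yes _ = tt
  ...     | no _  = tt

  b*M≡b*1+n*r : b * suc (r + r) ≡ b * 1 + n * r
  b*M≡b*1+n*r = identity b r
    where
    identity : ∀ b r → b * suc (r + r) ≡ b * 1 + (b + b) * r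
    identity = solve-∀

  open RoleColouring n r r b 1 ≤-refl b*M≡b*1+n*r baseOf copyOf hubOf vtx-valid hubOf-valid
         (λ t<nr t'<nr base≡ copy≡ → trans (sym (vtxIndex-baseOf t<nr)) (trans (cong₂ vtxIndex base≡ copy≡) (vtxIndex-baseOf t'<nr)))
         (λ y< y'< eq → trans (sym (hubIndex-hubOf y<)) (trans (cong hubIndex eq) (hubIndex-hubOf y'<)))
         parts-joined

  hubDef≤ : ∀ y → hubDef (hubOf y) ≤ 𝟙 (b ≤? y) + 𝟙 (suc n ≤? y) * b
  hubDef≤ y with y <? b
  ... | yes _ = z≤n
  ... | no y≮b with y <? n
  ...   | yes _ = ≤-trans (≤-reflexive (sym (𝟙-yes (b ≤? y) (≮⇒≥ y≮b)))) (m≤m+n _ _)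
  ...   | no y≮n with y ≟ n
  ...     | yes _  = ≤-trans (≤-reflexive (sym (𝟙-yes (b ≤? y) (≮⇒≥ y≮b)))) (m≤m+n _ _)
  ...     | no y≢n rewrite 𝟙-yes (b ≤? y) (≮⇒≥ y≮b) | 𝟙-yes (suc n ≤? y) (≤∧≢⇒< (≮⇒≥ y≮n) (y≢n ∘ sym)) =
                ≤-reflexive (cong suc (trans (*-identityʳ b) (sym (+-identityʳ b))))

  deficiency≤ : DefAtMost (Kpart n r) (n * r + 2)
  deficiency≤ = α , (begin
    totalDef (Kpart n r) α
      ≤⟨ totalDef≤ ⟩
    sumBelow (n + 2) (hubDef ∘ hubOf)
      ≤⟨ sumBelow-mono (n + 2) hubDef≤ ⟩
    sumBelow (n + 2) (λ y → 𝟙 (b ≤? y) + 𝟙 (suc n ≤? y) * b)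
      ≡⟨ sumBelow-+ (n + 2) _ _ ⟩
    sumBelow (n + 2) (λ y → 𝟙 (b ≤? y)) + sumBelow (n + 2) (λ y → 𝟙 (suc n ≤? y) * b)
      ≡⟨ cong₂ _+_ (count-≥ (n + 2) b) (trans (sumBelow-*ʳ (n + 2) _ b) (cong (_* b) (count-≥ (n + 2) (suc n)))) ⟩
    (n + 2 ∸ b) + (n + 2 ∸ suc n) * b
      ≡⟨ cong₂ (λ x y → x + y * b) after-first-half after-pole-A ⟩
    (b + 2) + 1 * b
      ≡⟨ rearrange b ⟩
    n * 1 + 2
      ≤⟨ +-monoˡ-≤ 2 (*-monoʳ-≤ n 1≤r) ⟩
    n * r + 2
      ∎)
    where
    open ≤-Reasoning
    after-first-half : n + 2 ∸ b ≡ b + 2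
    after-first-half = trans (cong (_∸ b) (+-assoc b b 2)) (m+n∸m≡n b (b + 2))
    after-pole-A : n + 2 ∸ suc n ≡ 1
    after-pole-A = trans (cong (n + 2 ∸_) (+-comm 1 n)) ([m+n]∸[m+o]≡n∸o n 2 1)
    rearrange : ∀ b → (b + 2) + 1 * b ≡ (b + b) * 1 + 2
    rearrange = solve-∀

even-or-odd : ∀ n r → 2 ∣ n * (r + 1) → (∃[ b ] n ≡ b + b) ⊎ (∃[ m ] r ≡ suc (m + m))
even-or-odd n r 2∣n[r+1] with 2 ∣? n
... | yes (divides b n≡b*2) = inj₁ (b , trans n≡b*2 (b*2≡b+b b))
  where
  b*2≡b+b : ∀ b → b * 2 ≡ b + b
  b*2≡b+b = solve-∀
... | no 2∤n with euclidsLemma n (r + 1) (from-yes (prime? 2)) 2∣n[r+1]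
...   | inj₁ 2∣n = contradiction 2∣n 2∤n
...   | inj₂ (divides zero r+1≡0) = contradiction (trans (+-comm 1 r) r+1≡0) λ ()
...   | inj₂ (divides (suc m) r+1≡[1+m]*2) = inj₂ (m , suc-injective (trans (+-comm 1 r) (trans r+1≡[1+m]*2 ([1+m]*2≡2+m+m m))))
  where
  [1+m]*2≡2+m+m : ∀ m → suc m * 2 ≡ suc (suc (m + m))
  [1+m]*2≡2+m+m = solve-∀

theorem11 : (n r : ℕ) → .{{_ : NonZero n}} → 1 ≤ r → 2 ∣ n * (r + 1) → DefAtMost (Kpart n r) (n * r + 2)
theorem11 n r 1≤r 2∣n[r+1] with even-or-odd n r 2∣n[r+1]
... | inj₁ (b , refl) = EvenParts.deficiency≤ b r 1≤r
... | inj₂ (m , refl) = OddParts.deficiency≤ n m
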